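{- If $(G,h_x)\in\mathcal{D}$, then $(G,h_x)$ is not AT.
   Context: All graphs are finite and simple. For an orientation $D$ of a graph, a spanning Eulerian subgraph is a spanning subgraph in which every vertex has indegree equal to outdegree; its parity is the parity of its number of edges. $EE(D)$ (resp. $EO(D)$) is the number of even (resp. odd) spanning Eulerian subgraphs of $D$. $D$ is an Alon--Tarsi (AT) orientation if $EE(D)\ne EO(D)$. For $h:V(G)\to\mathbb{N}$, the pair $(G,h)$ is AT if $G$ has an AT orientation in which every vertex $v$ has outdegree at most $d_G(v)-h(v)-1$ (equivalently indegree at least $h(v)+1$). For $x\in V(G)$, $h_x(x)=1$ and $h_x(v)=0$ for $v\ne x$. $\mathcal{D}$ is the set of pairs $(G,h_x)$ of the following types: (a) $G$ is obtained from $K_4$ on vertices $x,z_1,z_2,z_3$ by replacing each edge $xz_i$ with an $x$–$z_i$ path of odd length (internally disjoint, new internal vertices); (b) the same, but each path $x$–$z_i$ has even length at least 2; (c) $G$ is the Moser spindle (two disjoint triangles $abc$ and $a'b'c'$, the edge $aa'$, and a vertex $x$ adjacent to exactly $b,c,b',c'$) with $x$ its vertex of degree 4. -}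

module Defs where

open import Data.Nat using (ℕ; zero; suc; _+_; _<_; _≤_; _%_; _≟_; _≡ᵇ_)
open import Data.Bool using (Bool; true; false; if_then_else_)
open import Data.Product using (_×_; _,_; proj₁; proj₂; Σ; ∃; swap)
open import Data.Sum using (_⊎_)
open import Data.List using (List; []; _∷_; _++_; length; filter; map; upTo)
open import Data.List.Relation.Unary.All using (All)
open import Data.List.Relation.Unary.All as All using ()
open import Data.List.Relation.Binary.Pointwise using (Pointwise)
open import Data.List.Membership.Propositional using (_∈_)
open import Data.List.Relation.Unary.AllPairs using (AllPairs)
open import Relation.Binary.PropositionalEquality using (_≡_; _≢_)
open import Relation.Nullary using (¬_; Dec)
open import Relation.Nullary.Decidable using (_⊎-dec_; _×-dec_)
open import Function.Bundles using (_⇔_)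

-- Finite graphs.  Vertices are the naturals 0 .. n-1; edges are given
-- as a list of (unordered) pairs of endpoints.

record Graph : Set where
  constructor mkGraph
  field
    n     : ℕ
    edges : List (ℕ × ℕ)
open Graph public

SameEnds : ℕ × ℕ → ℕ × ℕ → Set
SameEnds e f = e ≡ f ⊎ e ≡ swap f

Simple : Graph → Set
Simple G =
  All (λ e → proj₁ e < n G × proj₂ e < n G) (edges G)
  × All (λ e → proj₁ e ≢ proj₂ e) (edges G)
  × AllPairs (λ e f → ¬ SameEnds e f) (edges G)

Adj : Graph → ℕ → ℕ → Set
Adj G u v = (u , v) ∈ edges G ⊎ (v , u) ∈ edges G

deg : Graph → ℕ → ℕ
deg G v = length (filter (λ e → (proj₁ e ≟ v) ⊎-dec (proj₂ e ≟ v)) (edges G))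

-- Orientations: a list of arcs (tail , head), one per edge of G, each
-- arc being the corresponding edge in one of its two directions.

IsOrientation : Graph → List (ℕ × ℕ) → Set
IsOrientation G arcs = Pointwise (λ e a → a ≡ e ⊎ a ≡ swap e) (edges G) arcs

outdeg : List (ℕ × ℕ) → ℕ → ℕ
outdeg arcs v = length (filter (λ a → proj₁ a ≟ v) arcs)

indeg : List (ℕ × ℕ) → ℕ → ℕ
indeg arcs v = length (filter (λ a → proj₂ a ≟ v) arcs)

-- all sub-lists (= all subsets of positions) of a list: 2^m of them
subsets : {A : Set} → List A → List (List A)
subsets []       = [] ∷ []
subsets (a ∷ as) = map (a ∷_) (subsets as) ++ subsets as

Eulerian : ℕ → List (ℕ × ℕ) → Set
Eulerian n S = All (λ v → indeg S v ≡ outdeg S v) (upTo n)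

Eulerian? : (n : ℕ) (S : List (ℕ × ℕ)) → Dec (Eulerian n S)
Eulerian? n S = All.all? (λ v → indeg S v ≟ outdeg S v) (upTo n)

EE : ℕ → List (ℕ × ℕ) → ℕ
EE n D = length (filter (λ S → Eulerian? n S ×-dec (length S % 2 ≟ 0)) (subsets D))

EO : ℕ → List (ℕ × ℕ) → ℕ
EO n D = length (filter (λ S → Eulerian? n S ×-dec (length S % 2 ≟ 1)) (subsets D))

IsAT : Graph → (ℕ → ℕ) → Set
IsAT G h = Σ (List (ℕ × ℕ)) λ D →
  IsOrientation G D
  × EE (n G) D ≢ EO (n G) D
  × All (λ v → outdeg D v + h v + 1 ≤ deg G v) (upTo (n G))

hx : ℕ → ℕ → ℕ
hx x v = if v ≡ᵇ x then 1 else 0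

record IsoAt (G : Graph) (x : ℕ) (H : Graph) (y : ℕ) : Set where
  field
    f     : ℕ → ℕ
    g     : ℕ → ℕ
    f<    : ∀ v → v < n G → f v < n H
    g<    : ∀ v → v < n H → g v < n G
    gf    : ∀ v → v < n G → g (f v) ≡ v
    fg    : ∀ v → v < n H → f (g v) ≡ v
    adj   : ∀ u v → u < n G → v < n G → (Adj G u v ⇔ Adj H (f u) (f v))
    x<    : x < n G
    fx    : f x ≡ y

-- path from u to t of length k+1 whose k internal vertices are
-- s, s+1, ..., s+k-1
pathE : ℕ → ℕ → ℕ → ℕ → List (ℕ × ℕ)
pathE u s zero    t = (u , t) ∷ []
pathE u s (suc k) t = (u , s) ∷ pathE s (suc s) k t

-- K4 on x = 0, z1 = 1, z2 = 2, z3 = 3, with edge x zi replaced by an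
-- x–zi path of length (ℓi + 1), internal vertices numbered from 4 on.
K4sub : ℕ → ℕ → ℕ → Graph
K4sub l1 l2 l3 = mkGraph (4 + l1 + l2 + l3)
  ((1 , 2) ∷ (1 , 3) ∷ (2 , 3) ∷
    (pathE 0 4 l1 1 ++ pathE 0 (4 + l1) l2 2 ++ pathE 0 (4 + l1 + l2) l3 3))

-- Moser spindle: a=0,b=1,c=2,a'=3,b'=4,c'=5, x=6
moser : Graph
moser = mkGraph 7
  ((0 , 1) ∷ (0 , 2) ∷ (1 , 2) ∷ (3 , 4) ∷ (3 , 5) ∷ (4 , 5) ∷ (0 , 3) ∷
   (6 , 1) ∷ (6 , 2) ∷ (6 , 4) ∷ (6 , 5) ∷ [])

Odd : ℕ → Set
Odd m = m % 2 ≡ 1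

Even : ℕ → Set
Even m = m % 2 ≡ 0

-- (G , h_x) ∈ 𝒟  (up to isomorphism sending x to the distinguished vertex)
data InD (G : Graph) (x : ℕ) : Set where
  typeA : ∀ l1 l2 l3 → Odd (suc l1) → Odd (suc l2) → Odd (suc l3) →
          IsoAt G x (K4sub l1 l2 l3) 0 → InD G x
  typeB : ∀ l1 l2 l3 → Even (suc l1) → Even (suc l2) → Even (suc l3) →
          IsoAt G x (K4sub l1 l2 l3) 0 → InD G x
  typeC : IsoAt G x moser 6 → InD G x

-- For a list D of integer-weighted arcs and a demand β : ℕ → ℤ, the signed
-- count σ n β D sums, over the sub-lists S of D whose net inflow at every
-- vertex v < n equals β v, the product of the weights of S.  With every
-- weight -1 and β = 0 it is EE(D) - EO(D).  σ is invariant under reordering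
-- arcs and relabelling vertices, and obeys local rules at a vertex touched
-- by few arcs: a lone arc there is unusable, two arcs entering it cancel,
-- and a path u → v → t through it contracts to one arc u → t.

module Submission where

open import Defs
open import Data.Nat as ℕ using (ℕ; zero; suc; _<_; _≤_; _%_; _≤ᵇ_; _≤?_; _<?_; z≤n; s≤s; z<s; s<s)
import Data.Nat.Properties as ℕP
import Data.Nat.DivMod as ℕDM
open import Data.Integer as ℤ using (ℤ; +_; -[1+_]; _-_; -_)
import Data.Integer.Properties as ℤP
open import Data.Integer.Tactic.RingSolver using (solve-∀)
open import Data.Bool using (Bool; true; false; _∧_; if_then_else_; T)
import Data.Bool.Properties as BoolP
open import Data.Unit using (⊤; tt)
open import Data.Empty using (⊥; ⊥-elim)
open import Data.Product using (Σ; _×_; _,_; proj₁; proj₂; swap)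
import Data.Product.Properties as ProductP
open import Data.Sum using (_⊎_; inj₁; inj₂)
open import Data.List using (List; []; _∷_; map; _++_; length; filter; upTo)
open import Data.List.Properties
  using (∷-injective; map-++; ++-assoc; ++-identityʳ; length-++; filter-++; filter-none; filter-accept; filter-reject)
open import Data.List.Membership.Propositional using (_∈_)
open import Data.List.Membership.Propositional.Properties using (∈-map⁺; ∈-map⁻; ∈-++⁺ˡ; ∈-++⁺ʳ; ∈-upTo⁺; ∈-upTo⁻)
open import Data.List.Membership.Propositional.Properties.WithK using (unique∧set⇒bag)
open import Data.List.Relation.Binary.BagAndSetEquality using (_∼[_]_; set; ∼bag⇒↭)
open import Data.List.Relation.Binary.Permutation.Propositional as ↭ using (_↭_)
import Data.List.Relation.Binary.Permutation.Propositional.Properties as Perm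
open import Data.List.Relation.Binary.Pointwise using (Pointwise; []; _∷_)
import Data.List.Relation.Binary.Pointwise as Pointwise
open import Data.List.Relation.Unary.All using (All; []; _∷_)
import Data.List.Relation.Unary.All as All
import Data.List.Relation.Unary.All.Properties as All
open import Data.List.Relation.Unary.AllPairs using (AllPairs; []; _∷_; allPairs?)
import Data.List.Relation.Unary.AllPairs as AllPairs
import Data.List.Relation.Unary.AllPairs.Properties as AllPairs
open import Data.List.Relation.Unary.Any using (here; there)
open import Data.List.Relation.Unary.Unique.Propositional using (Unique)
open import Function.Bundles using (_⇔_; mk⇔; Equivalence)
open import Relation.Unary using (Decidable)
open import Relation.Nullary using (¬_; Dec; yes; no; does)
open import Relation.Nullary.Decidable using (from-yes; ¬?; _×-dec_; _⊎-dec_; _→-dec_)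
open import Relation.Binary.PropositionalEquality

-- arcs (tail , head), and arcs carrying an integer weight
Arc : Set
Arc = ℕ × ℕ

WArc : Set
WArc = Arc × ℤ

All<⇒ : ∀ {P : ℕ → Set} n → All P (upTo n) → ∀ v → v < n → P v
All<⇒ n ps v v<n = All.lookup ps (∈-upTo⁺ v<n)

⇒All< : ∀ {P : ℕ → Set} n → (∀ v → v < n → P v) → All P (upTo n)
⇒All< n ps = All.tabulate (λ v∈ → ps _ (∈-upTo⁻ v∈))

bool-iff : ∀ {a b : Bool} → (a ≡ true → b ≡ true) → (b ≡ true → a ≡ true) → a ≡ b
bool-iff {true}  {true}  _ _ = refl
bool-iff {true}  {false} f _ = sym (f refl)
bool-iff {false} {true}  _ g = g refl
bool-iff {false} {false} _ _ = refl

-- Demands.  A demand β : ℕ → ℤ prescribes a net inflow at every vertex;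
-- a set S of arcs meets β on [0, n) when inflow minus outflow of S is β
-- at every v < n.

ind : ℕ → ℕ → ℤ
ind a v = if a ℕ.≡ᵇ v then + 1 else + 0

flow : Arc → ℕ → ℤ
flow (a , b) v = ind b v - ind a v

-- the demand left over once the arc a has been used
_⊖_ : (ℕ → ℤ) → Arc → ℕ → ℤ
(β ⊖ a) v = β v - flow a v

vanishes : ℕ → (ℕ → ℤ) → Bool
vanishes zero    β = true
vanishes (suc n) β = does (β n ℤ.≟ + 0) ∧ vanishes n β

vanishes-sound : ∀ n β → vanishes n β ≡ true → ∀ v → v < n → β v ≡ + 0
vanishes-sound (suc n) β h v v<1+n with β n ℤ.≟ + 0 | ℕP.m≤n⇒m<n∨m≡n (ℕP.≤-pred v<1+n)
... | yes βn≡0 | inj₂ refl = βn≡0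
... | yes _    | inj₁ v<n  = vanishes-sound n β h v v<n

vanishes-complete : ∀ n β → (∀ v → v < n → β v ≡ + 0) → vanishes n β ≡ true
vanishes-complete zero    β h = refl
vanishes-complete (suc n) β h with β n ℤ.≟ + 0
... | yes _   = vanishes-complete n β (λ v v<n → h v (ℕP.m<n⇒m<1+n v<n))
... | no βn≢0 = ⊥-elim (βn≢0 (h n (ℕP.n<1+n n)))

vanishes-cong : ∀ n {β β'} → (∀ v → v < n → β v ≡ β' v) → vanishes n β ≡ vanishes n β'
vanishes-cong n {β} {β'} β≗β' = bool-iff
  (λ h → vanishes-complete n β' (λ v v<n → trans (sym (β≗β' v v<n)) (vanishes-sound n β h v v<n)))
  (λ h → vanishes-complete n β (λ v v<n → trans (β≗β' v v<n) (vanishes-sound n β' h v v<n)))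

vanishes-witness : ∀ n β v → v < n → β v ≢ + 0 → vanishes n β ≡ false
vanishes-witness n β v v<n βv≢0 with vanishes n β in eq
... | true  = ⊥-elim (βv≢0 (vanishes-sound n β eq v v<n))
... | false = refl

-- The signed count.  σ n β D is the sum, over all sub-lists S of the
-- weighted arc list D that meet β on [0, n), of the product of the
-- weights of S.  With all weights -1 and β = 0 it is EE - EO
-- (lemma EE≢EO⇒σ≢0 below); its recursive definition makes the local
-- reductions of this section provable by algebra alone.

σ : ℕ → (ℕ → ℤ) → List WArc → ℤ
σ n β []            = if vanishes n β then + 1 else + 0
σ n β ((a , w) ∷ D) = σ n β D ℤ.+ w ℤ.* σ n (β ⊖ a) D

σ-cong : ∀ n D {β β'} → (∀ v → v < n → β v ≡ β' v) → σ n β D ≡ σ n β' D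
σ-cong n []            β≗β' = cong (λ b → if b then + 1 else + 0) (vanishes-cong n β≗β')
σ-cong n ((a , w) ∷ D) β≗β' =
  cong₂ (λ p q → p ℤ.+ w ℤ.* q) (σ-cong n D β≗β') (σ-cong n D (λ v v<n → cong (_- flow a v) (β≗β' v v<n)))

σ-∷ : ∀ n a w X Y → (∀ β → σ n β X ≡ σ n β Y) → ∀ β → σ n β ((a , w) ∷ X) ≡ σ n β ((a , w) ∷ Y)
σ-∷ n a w X Y X≈Y β = cong₂ (λ p q → p ℤ.+ w ℤ.* q) (X≈Y β) (X≈Y (β ⊖ a))

-- swapping two adjacent arcs: both orders expand to the same four terms
σ-swap : ∀ n β p q D → σ n β (p ∷ q ∷ D) ≡ σ n β (q ∷ p ∷ D)
σ-swap n β (a , wa) (b , wb) D = begin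
  (X ℤ.+ wb ℤ.* Y) ℤ.+ wa ℤ.* (Z ℤ.+ wb ℤ.* σ n ((β ⊖ a) ⊖ b) D)
    ≡⟨ cong (λ u → (X ℤ.+ wb ℤ.* Y) ℤ.+ wa ℤ.* (Z ℤ.+ wb ℤ.* u)) (σ-cong n D ⊖-comm) ⟩
  (X ℤ.+ wb ℤ.* Y) ℤ.+ wa ℤ.* (Z ℤ.+ wb ℤ.* U)
    ≡⟨ exchange X Y Z U wa wb ⟩
  (X ℤ.+ wa ℤ.* Z) ℤ.+ wb ℤ.* (Y ℤ.+ wa ℤ.* U) ∎
  where
  open ≡-Reasoning
  X Y Z U : ℤ
  X = σ n β D
  Y = σ n (β ⊖ b) D
  Z = σ n (β ⊖ a) D
  U = σ n ((β ⊖ b) ⊖ a) D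
  ⊖-comm : ∀ v → v < n → ((β ⊖ a) ⊖ b) v ≡ ((β ⊖ b) ⊖ a) v
  ⊖-comm v _ = reorder (β v) (flow a v) (flow b v)
    where
    reorder : ∀ (x p q : ℤ) → (x - p) - q ≡ (x - q) - p
    reorder = solve-∀
  exchange : ∀ (X Y Z U wa wb : ℤ) →
    (X ℤ.+ wb ℤ.* Y) ℤ.+ wa ℤ.* (Z ℤ.+ wb ℤ.* U) ≡ (X ℤ.+ wa ℤ.* Z) ℤ.+ wb ℤ.* (Y ℤ.+ wa ℤ.* U)
  exchange = solve-∀

σ-perm : ∀ n {D D'} → D ↭ D' → ∀ β → σ n β D ≡ σ n β D'
σ-perm n ↭.refl                         β = refl
σ-perm n (↭.prep {xs = X} {ys = Y} (a , w) p) β = σ-∷ n a w X Y (σ-perm n p) β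
σ-perm n (↭.swap {xs = X} {ys = Y} p q r) β =
  trans (σ-swap n β p q X)
        (σ-∷ n (proj₁ q) (proj₂ q) (p ∷ X) (p ∷ Y) (σ-∷ n (proj₁ p) (proj₂ p) X Y (σ-perm n r)) β)
σ-perm n (↭.trans p q) β = trans (σ-perm n p β) (σ-perm n q β)

-- Local reductions at a vertex v that no other arc touches.

Avoids : ℕ → Arc → Set
Avoids v (a , b) = a ≢ v × b ≢ v

Misses : ℕ → List WArc → Set
Misses v D = All (λ p → Avoids v (proj₁ p)) D

ind-self : ∀ v → ind v v ≡ + 1
ind-self v with v ℕ.≡ᵇ v | ℕP.≡⇒≡ᵇ v v refl
... | true | _ = refl

ind-other : ∀ {a v} → a ≢ v → ind a v ≡ + 0
ind-other {a} {v} a≢v with a ℕ.≡ᵇ v | ℕP.≡ᵇ⇒≡ a v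
... | true  | a≡v = ⊥-elim (a≢v (a≡v _))
... | false | _   = refl

⊖-avoid : ∀ β a v → Avoids v a → (β ⊖ a) v ≡ β v
⊖-avoid β (a , b) v (a≢v , b≢v) rewrite ind-other a≢v | ind-other b≢v = ℤP.+-identityʳ (β v)

⊖-enter : ∀ β u v → β v ≡ + 0 → u ≢ v → (β ⊖ (u , v)) v ≡ -[1+ 0 ]
⊖-enter β u v βv≡0 u≢v rewrite βv≡0 | ind-self v | ind-other u≢v = refl

⊖-leave : ∀ β v t → β v ≡ + 0 → t ≢ v → (β ⊖ (v , t)) v ≡ + 1
⊖-leave β v t βv≡0 t≢v rewrite βv≡0 | ind-self v | ind-other t≢v = refl

σ-unmet : ∀ n D β v → v < n → Misses v D → β v ≢ + 0 → σ n β D ≡ + 0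
σ-unmet n [] β v v<n _ βv≢0 rewrite vanishes-witness n β v v<n βv≢0 = refl
σ-unmet n ((a , w) ∷ D) β v v<n (a-avoids ∷ D-misses) βv≢0
  rewrite σ-unmet n D β v v<n D-misses βv≢0
        | σ-unmet n D (β ⊖ a) v v<n D-misses (λ eq → βv≢0 (trans (sym (⊖-avoid β a v a-avoids)) eq))
        | ℤP.*-zeroʳ w = refl

σ-pendant : ∀ n D β a w v → v < n → Misses v D → β v ≡ + 0 → flow a v ≢ + 0 →
            σ n β ((a , w) ∷ D) ≡ σ n β D
σ-pendant n D β a w v v<n D-misses βv≡0 flow≢0
  = begin
    σ n β D ℤ.+ w ℤ.* σ n (β ⊖ a) D ≡⟨ cong (λ z → σ n β D ℤ.+ w ℤ.* z) (σ-unmet n D (β ⊖ a) v v<n D-misses unbalanced) ⟩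
    σ n β D ℤ.+ w ℤ.* + 0           ≡⟨ cong (λ z → σ n β D ℤ.+ z) (ℤP.*-zeroʳ w) ⟩
    σ n β D ℤ.+ + 0                 ≡⟨ ℤP.+-identityʳ _ ⟩
    σ n β D                         ∎
  where
  open ≡-Reasoning
  unbalanced : (β ⊖ a) v ≢ + 0
  unbalanced eq = 0-nonzero (flow a v) flow≢0 (subst (λ x → x - flow a v ≡ + 0) βv≡0 eq)
    where
    0-nonzero : ∀ z → z ≢ + 0 → + 0 - z ≢ + 0
    0-nonzero (+ zero)  z≢0 _ = z≢0 refl
    0-nonzero (+ suc _) _ ()
    0-nonzero -[1+ _ ]  _ ()

σ-sink : ∀ n D β u t v wu wt → v < n → Misses v D → β v ≡ + 0 → u ≢ v → t ≢ v →
         σ n β (((u , v) , wu) ∷ ((t , v) , wt) ∷ D) ≡ σ n β D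
σ-sink n D β u t v wu wt v<n D-misses βv≡0 u≢v t≢v =
  begin
    (σ n β D ℤ.+ wt ℤ.* σ n (β ⊖ (t , v)) D) ℤ.+ wu ℤ.* (σ n (β ⊖ (u , v)) D ℤ.+ wt ℤ.* σ n ((β ⊖ (u , v)) ⊖ (t , v)) D)
  ≡⟨ cong₂ (λ p q → (σ n β D ℤ.+ wt ℤ.* p) ℤ.+ wu ℤ.* q)
       (σ-unmet n D _ v v<n D-misses (λ eq → -1≢0 (trans (sym (⊖-enter β t v βv≡0 t≢v)) eq)))
       (cong₂ (λ p q → p ℤ.+ wt ℤ.* q)
         (σ-unmet n D _ v v<n D-misses (λ eq → -1≢0 (trans (sym (⊖-enter β u v βv≡0 u≢v)) eq)))
         (σ-unmet n D _ v v<n D-misses -2≢0)) ⟩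
    (σ n β D ℤ.+ wt ℤ.* + 0) ℤ.+ wu ℤ.* (+ 0 ℤ.+ wt ℤ.* + 0)
  ≡⟨ cancel (σ n β D) wu wt ⟩
    σ n β D
  ∎
  where
  open ≡-Reasoning
  -1≢0 : -[1+ 0 ] ≢ + 0
  -1≢0 ()
  -2≢0 : ((β ⊖ (u , v)) ⊖ (t , v)) v ≢ + 0
  -2≢0 eq rewrite ⊖-enter β u v βv≡0 u≢v | ind-self v | ind-other t≢v with eq
  ... | ()
  cancel : ∀ (X wu wt : ℤ) → (X ℤ.+ wt ℤ.* + 0) ℤ.+ wu ℤ.* (+ 0 ℤ.+ wt ℤ.* + 0) ≡ X
  cancel = solve-∀

σ-contract : ∀ n D β u v t wu wt → v < n → Misses v D → β v ≡ + 0 → u ≢ v → t ≢ v →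
             σ n β (((u , v) , wu) ∷ ((v , t) , wt) ∷ D) ≡ σ n β (((u , t) , wu ℤ.* wt) ∷ D)
σ-contract n D β u v t wu wt v<n D-misses βv≡0 u≢v t≢v =
  begin
    (σ n β D ℤ.+ wt ℤ.* σ n (β ⊖ (v , t)) D) ℤ.+ wu ℤ.* (σ n (β ⊖ (u , v)) D ℤ.+ wt ℤ.* σ n ((β ⊖ (u , v)) ⊖ (v , t)) D)
  ≡⟨ cong₂ (λ p q → (σ n β D ℤ.+ wt ℤ.* p) ℤ.+ wu ℤ.* q)
       (σ-unmet n D _ v v<n D-misses (λ eq → +1≢0 (trans (sym (⊖-leave β v t βv≡0 t≢v)) eq)))
       (cong₂ (λ p q → p ℤ.+ wt ℤ.* q)
         (σ-unmet n D _ v v<n D-misses (λ eq → -1≢0 (trans (sym (⊖-enter β u v βv≡0 u≢v)) eq)))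
         (σ-cong n D through)) ⟩
    (σ n β D ℤ.+ wt ℤ.* + 0) ℤ.+ wu ℤ.* (+ 0 ℤ.+ wt ℤ.* σ n (β ⊖ (u , t)) D)
  ≡⟨ collect (σ n β D) (σ n (β ⊖ (u , t)) D) wu wt ⟩
    σ n β D ℤ.+ (wu ℤ.* wt) ℤ.* σ n (β ⊖ (u , t)) D
  ∎
  where
  open ≡-Reasoning
  -1≢0 : -[1+ 0 ] ≢ + 0
  -1≢0 ()
  +1≢0 : + 1 ≢ + 0
  +1≢0 ()
  through : ∀ x → x < n → ((β ⊖ (u , v)) ⊖ (v , t)) x ≡ (β ⊖ (u , t)) x
  through x _ = telescope (β x) (ind u x) (ind v x) (ind t x)
    where
    telescope : ∀ (b iu iv it : ℤ) → (b - (iv - iu)) - (it - iv) ≡ b - (it - iu)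
    telescope = solve-∀
  collect : ∀ (X U wu wt : ℤ) →
    (X ℤ.+ wt ℤ.* + 0) ℤ.+ wu ℤ.* (+ 0 ℤ.+ wt ℤ.* U) ≡ X ℤ.+ (wu ℤ.* wt) ℤ.* U
  collect = solve-∀

Within : ℕ → Arc → Set
Within n e = proj₁ e < n × proj₂ e < n

ZeroOn : (ℕ → Set) → (ℕ → ℤ) → Set
ZeroOn Z β = ∀ v → Z v → β v ≡ + 0

MissesAll : (ℕ → Set) → List WArc → Set
MissesAll Z D = ∀ v → Z v → Misses v D

σ-prefix : ∀ n Z P X Y → MissesAll Z P → (∀ β → ZeroOn Z β → σ n β X ≡ σ n β Y) →
           ∀ β → ZeroOn Z β → σ n β (P ++ X) ≡ σ n β (P ++ Y)
σ-prefix n Z []            X Y _ X≈Y β β0 = X≈Y β β0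
σ-prefix n Z ((a , w) ∷ P) X Y P-misses X≈Y β β0 =
  cong₂ (λ p q → p ℤ.+ w ℤ.* q) (σ-prefix n Z P X Y tail-misses X≈Y β β0)
    (σ-prefix n Z P X Y tail-misses X≈Y (β ⊖ a) ⊖a-zero)
  where
  tail-misses : MissesAll Z P
  tail-misses v v∈Z = All.tail (P-misses v v∈Z)
  ⊖a-zero : ZeroOn Z (β ⊖ a)
  ⊖a-zero v v∈Z = trans (⊖-avoid β a v (All.head (P-misses v v∈Z))) (β0 v v∈Z)

σ-restrict : ∀ m n L β → m ≤ n → All (λ p → Within m (proj₁ p)) L →
             (∀ v → m ≤ v → v < n → β v ≡ + 0) → σ n β L ≡ σ m β L
σ-restrict m n [] β m≤n _ β0 = cong (λ b → if b then + 1 else + 0) (bool-iff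
  (λ h → vanishes-complete m β (λ v v<m → vanishes-sound n β h v (ℕP.<-≤-trans v<m m≤n)))
  (λ h → vanishes-complete n β (λ v v<n → outside v v<n h)))
  where
  outside : ∀ v → v < n → vanishes m β ≡ true → β v ≡ + 0
  outside v v<n h with v ℕP.<? m
  ... | yes v<m = vanishes-sound m β h v v<m
  ... | no v≮m  = β0 v (ℕP.≮⇒≥ v≮m) v<n
σ-restrict m n (((a , b) , w) ∷ L) β m≤n ((a<m , b<m) ∷ L-within) β0 =
  cong₂ (λ p q → p ℤ.+ w ℤ.* q) (σ-restrict m n L β m≤n L-within β0)
    (σ-restrict m n L (β ⊖ (a , b)) m≤n L-within
      (λ v m≤v v<n → trans (⊖-avoid β (a , b) v (beyond a<m m≤v , beyond b<m m≤v)) (β0 v m≤v v<n)))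
  where
  beyond : ∀ {c v} → c < m → m ≤ v → c ≢ v
  beyond c<m m≤v refl = ℕP.<-irrefl refl (ℕP.<-≤-trans c<m m≤v)

relabelArc : (ℕ → ℕ) → Arc → Arc
relabelArc f (a , b) = (f a , f b)

relabelW : (ℕ → ℕ) → WArc → WArc
relabelW f (a , w) = (relabelArc f a , w)

module Relabel (n m : ℕ) (f g : ℕ → ℕ)
  (f< : ∀ v → v < n → f v < m) (g< : ∀ w → w < m → g w < n)
  (fg : ∀ w → w < m → f (g w) ≡ w) (f-inj : ∀ u v → u < n → v < n → f u ≡ f v → u ≡ v) where

  vanishes-relabel : ∀ β β' → (∀ v → v < n → β' (f v) ≡ β v) → vanishes m β' ≡ vanishes n β
  vanishes-relabel β β' β'∘f≗β = bool-iff
    (λ h → vanishes-complete n β (λ v v<n →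
      trans (sym (β'∘f≗β v v<n)) (vanishes-sound m β' h (f v) (f< v v<n))))
    (λ h → vanishes-complete m β' (λ w w<m →
      trans (cong β' (sym (fg w w<m))) (trans (β'∘f≗β (g w) (g< w w<m)) (vanishes-sound n β h (g w) (g< w w<m)))))

  ind-relabel : ∀ a v → a < n → v < n → ind (f a) (f v) ≡ ind a v
  ind-relabel a v a<n v<n with a ℕ.≟ v
  ... | yes refl = trans (ind-self (f a)) (sym (ind-self a))
  ... | no a≢v   = trans (ind-other (λ eq → a≢v (f-inj a v a<n v<n eq))) (sym (ind-other a≢v))

  σ-relabel : ∀ D β β' → All (λ p → Within n (proj₁ p)) D → (∀ v → v < n → β' (f v) ≡ β v) →
              σ m β' (map (relabelW f) D) ≡ σ n β D
  σ-relabel [] β β' _ β'∘f≗β = cong (λ b → if b then + 1 else + 0) (vanishes-relabel β β' β'∘f≗β)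
  σ-relabel (((a , b) , w) ∷ D) β β' ((a<n , b<n) ∷ D-within) β'∘f≗β =
    cong₂ (λ p q → p ℤ.+ w ℤ.* q) (σ-relabel D β β' D-within β'∘f≗β)
      (σ-relabel D (β ⊖ (a , b)) (β' ⊖ (f a , f b)) D-within
        (λ v v<n → cong₂ (λ x y → x - y) (β'∘f≗β v v<n)
                     (cong₂ _-_ (ind-relabel b v b<n v<n) (ind-relabel a v a<n v<n))))

-- σ computes EE - EO.

module _ {A : Set} where

  length-filter-cong : ∀ {P Q R : A → Set} (P? : Decidable P) (Q? : Decidable Q) xs → All R xs →
    (∀ x → R x → P x → Q x) → (∀ x → R x → Q x → P x) → length (filter P? xs) ≡ length (filter Q? xs)
  length-filter-cong P? Q? []       _        _ _ = refl
  length-filter-cong P? Q? (x ∷ xs) (r ∷ rs) P⇒Q Q⇒P with P? x | Q? x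
  ... | yes _  | yes _  = cong suc (length-filter-cong P? Q? xs rs P⇒Q Q⇒P)
  ... | no _   | no _   = length-filter-cong P? Q? xs rs P⇒Q Q⇒P
  ... | yes px | no ¬qx = ⊥-elim (¬qx (P⇒Q x r px))
  ... | no ¬px | yes qx = ⊥-elim (¬px (Q⇒P x r qx))

  length-filter-++ : ∀ {P : A → Set} (P? : Decidable P) xs ys →
    length (filter P? (xs ++ ys)) ≡ length (filter P? xs) ℕ.+ length (filter P? ys)
  length-filter-++ P? xs ys rewrite filter-++ P? xs ys = length-++ (filter P? xs)

  length-filter-map : ∀ {B : Set} {P : B → Set} (P? : Decidable P) (h : A → B) xs →
    length (filter P? (map h xs)) ≡ length (filter (λ x → P? (h x)) xs)
  length-filter-map P? h []       = refl
  length-filter-map P? h (x ∷ xs) with P? (h x)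
  ... | yes _ = cong suc (length-filter-map P? h xs)
  ... | no _  = length-filter-map P? h xs

All-trivial : ∀ {A : Set} (xs : List A) → All (λ _ → ⊤) xs
All-trivial xs = All.universal (λ _ → tt) xs

%2-suc-suc : ∀ m → suc (suc m) % 2 ≡ m % 2
%2-suc-suc m = trans (cong (_% 2) (ℕP.+-comm 2 m)) (ℕDM.[m+n]%n≡m%n m 2)

suc-parity : ∀ m → (m % 2 ≡ 0 × suc m % 2 ≡ 1) ⊎ (m % 2 ≡ 1 × suc m % 2 ≡ 0)
suc-parity zero = inj₁ (refl , refl)
suc-parity (suc m) with suc-parity m
... | inj₁ (m-even , sm-odd) = inj₂ (sm-odd , trans (%2-suc-suc m) m-even)
... | inj₂ (m-odd , sm-even) = inj₁ (sm-even , trans (%2-suc-suc m) m-odd)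

0≢1 : 0 ≢ 1
0≢1 ()

suc-even⇔odd : ∀ m → (suc m % 2 ≡ 0) ⇔ (m % 2 ≡ 1)
suc-even⇔odd m with suc-parity m
... | inj₁ (m-even , sm-odd) = mk⇔ (λ sm-even → ⊥-elim (0≢1 (trans (sym sm-even) sm-odd)))
                                   (λ m-odd → ⊥-elim (0≢1 (trans (sym m-even) m-odd)))
... | inj₂ (m-odd , sm-even) = mk⇔ (λ _ → m-odd) (λ _ → sm-even)

suc-odd⇔even : ∀ m → (suc m % 2 ≡ 1) ⇔ (m % 2 ≡ 0)
suc-odd⇔even m with suc-parity m
... | inj₁ (m-even , sm-odd) = mk⇔ (λ _ → m-even) (λ _ → sm-odd)
... | inj₂ (m-odd , sm-even) = mk⇔ (λ sm-odd → ⊥-elim (0≢1 (trans (sym sm-even) sm-odd)))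
                                   (λ m-even → ⊥-elim (0≢1 (trans (sym m-even) m-odd)))

balance : List Arc → ℕ → ℤ
balance S v = + indeg S v - + outdeg S v

meets : ℕ → (ℕ → ℤ) → List Arc → Bool
meets n β S = vanishes n (λ v → β v - balance S v)

count : ℕ → (ℕ → ℤ) → ℕ → List Arc → ℕ
count n β p D = length (filter (λ S → (meets n β S BoolP.≟ true) ×-dec (length S % 2 ℕ.≟ p)) (subsets D))

meets-∷ : ∀ n β a S → meets n β (a ∷ S) ≡ meets n (β ⊖ a) S
meets-∷ n β (x , y) S = vanishes-cong n (λ v _ → begin
    β v - ((+ indeg ((x , y) ∷ S) v) - (+ outdeg ((x , y) ∷ S) v))
  ≡⟨ cong₂ (λ i o → β v - (i - o)) (indeg-∷ v) (outdeg-∷ v) ⟩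
    β v - ((ind y v ℤ.+ + indeg S v) - (ind x v ℤ.+ + outdeg S v))
  ≡⟨ regroup (β v) (ind y v) (ind x v) (+ indeg S v) (+ outdeg S v) ⟩
    (β v - (ind y v - ind x v)) - (+ indeg S v - + outdeg S v)
  ∎)
  where
  open ≡-Reasoning
  indeg-∷ : ∀ v → + indeg ((x , y) ∷ S) v ≡ ind y v ℤ.+ + indeg S v
  indeg-∷ v with y ℕ.≡ᵇ v
  ... | true  = refl
  ... | false = refl
  outdeg-∷ : ∀ v → + outdeg ((x , y) ∷ S) v ≡ ind x v ℤ.+ + outdeg S v
  outdeg-∷ v with x ℕ.≡ᵇ v
  ... | true  = refl
  ... | false = refl
  regroup : ∀ (b iy ix I O : ℤ) → b - ((iy ℤ.+ I) - (ix ℤ.+ O)) ≡ (b - (iy - ix)) - (I - O)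
  regroup = solve-∀

-- Sub-lists of a ∷ D either use a (and then D must meet β ⊖ a with the
-- other parity) or do not.
count-∷ : ∀ n β p q a D → (∀ m → (suc m % 2 ≡ p) ⇔ (m % 2 ≡ q)) →
          count n β p (a ∷ D) ≡ count n (β ⊖ a) q D ℕ.+ count n β p D
count-∷ n β p q a D parity =
  trans (length-filter-++ Pβ (map (a ∷_) (subsets D)) (subsets D))
    (cong (ℕ._+ count n β p D)
      (trans (length-filter-map Pβ (a ∷_) (subsets D))
        (length-filter-cong (λ S → Pβ (a ∷ S)) Q (subsets D) (All-trivial (subsets D))
          (λ S _ (m , par) → trans (sym (meets-∷ n β a S)) m , Equivalence.to (parity (length S)) par)
          (λ S _ (m , par) → trans (meets-∷ n β a S) m , Equivalence.from (parity (length S)) par))))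
  where
  Pβ : Decidable (λ S → (meets n β S ≡ true) × (length S % 2 ≡ p))
  Pβ = λ S → (meets n β S BoolP.≟ true) ×-dec (length S % 2 ℕ.≟ p)
  Q : Decidable (λ S → (meets n (β ⊖ a) S ≡ true) × (length S % 2 ≡ q))
  Q  = λ S → (meets n (β ⊖ a) S BoolP.≟ true) ×-dec (length S % 2 ℕ.≟ q)

negW : List Arc → List WArc
negW = map (λ a → a , -[1+ 0 ])

negW-within : ∀ m D → All (Within m) D → All (λ p → Within m (proj₁ p)) (negW D)
negW-within m []      []       = []
negW-within m (_ ∷ D) (w ∷ ws) = w ∷ negW-within m D ws

σ-negW : ∀ n D β → σ n β (negW D) ≡ + count n β 0 D - + count n β 1 D
σ-negW n [] β with meets n β [] | vanishes-cong n {β} {λ v → β v - balance [] v} (λ v _ → sym (ℤP.+-identityʳ (β v)))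
... | true  | eq rewrite eq = refl
... | false | eq rewrite eq = refl
σ-negW n (a ∷ D) β
  rewrite count-∷ n β 0 1 a D suc-even⇔odd | count-∷ n β 1 0 a D suc-odd⇔even
        | σ-negW n D β | σ-negW n D (β ⊖ a)
        | ℤP.pos-+ (count n (β ⊖ a) 1 D) (count n β 0 D)
        | ℤP.pos-+ (count n (β ⊖ a) 0 D) (count n β 1 D)
  = alternate (+ count n β 0 D) (+ count n β 1 D) (+ count n (β ⊖ a) 0 D) (+ count n (β ⊖ a) 1 D)
  where
  alternate : ∀ (e o e' o' : ℤ) → (e - o) ℤ.+ -[1+ 0 ] ℤ.* (e' - o') ≡ (o' ℤ.+ e) - (e' ℤ.+ o)
  alternate = solve-∀

eulerian⇔meets : ∀ n S → Eulerian n S ⇔ (meets n (λ _ → + 0) S ≡ true)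
eulerian⇔meets n S = mk⇔
  (λ eul → vanishes-complete n _ (λ v v<n →
     subst (λ o → + 0 - (+ indeg S v - + o) ≡ + 0) (All<⇒ n eul v v<n) (zero-diff (indeg S v))))
  (λ m → ⇒All< n (λ v v<n → ℤP.+-injective (ℤP.i-j≡0⇒i≡j _ _ (neg-zero (vanishes-sound n _ m v v<n)))))
  where
  zero-diff : ∀ i → + 0 - (+ i - + i) ≡ + 0
  zero-diff i = cong (λ z → + 0 - z) (ℤP.+-inverseʳ (+ i))
  neg-zero : ∀ {z} → + 0 - z ≡ + 0 → z ≡ + 0
  neg-zero {z} eq = ℤP.neg-injective (trans (sym (ℤP.+-identityˡ (- z))) eq)

eulerian-count : ∀ n D p → length (filter (λ S → Eulerian? n S ×-dec (length S % 2 ℕ.≟ p)) (subsets D))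
                           ≡ count n (λ _ → + 0) p D
eulerian-count n D p = length-filter-cong _ _ (subsets D) (All-trivial (subsets D))
  (λ S _ (eul , par) → Equivalence.to (eulerian⇔meets n S) eul , par)
  (λ S _ (m , par) → Equivalence.from (eulerian⇔meets n S) m , par)

EE≢EO⇒σ≢0 : ∀ n D → EE n D ≢ EO n D → σ n (λ _ → + 0) (negW D) ≢ + 0
EE≢EO⇒σ≢0 n D EE≢EO σ≡0 = EE≢EO (begin
  EE n D                         ≡⟨ eulerian-count n D 0 ⟩
  count n (λ _ → + 0) 0 D        ≡⟨ ℤP.+-injective (ℤP.i-j≡0⇒i≡j _ _ (trans (sym (σ-negW n D _)) σ≡0)) ⟩
  count n (λ _ → + 0) 1 D        ≡⟨ eulerian-count n D 1 ⟨
  EO n D                         ∎)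
  where open ≡-Reasoning

-- Unordered edges.  norm e is e with its endpoints in increasing order;
-- two pairs have the same ends exactly when their normal forms agree.

norm : Arc → Arc
norm (a , b) = if a ≤ᵇ b then (a , b) else (b , a)

norm-swap : ∀ e → norm (swap e) ≡ norm e
norm-swap (a , b) with a ≤ᵇ b in a≤b | b ≤ᵇ a in b≤a
... | true  | true  = cong₂ _,_ (ℕP.≤-antisym (≤ᵇ-true b≤a) (≤ᵇ-true a≤b)) (ℕP.≤-antisym (≤ᵇ-true a≤b) (≤ᵇ-true b≤a))
  where
  ≤ᵇ-true : ∀ {m n} → (m ≤ᵇ n) ≡ true → m ≤ n
  ≤ᵇ-true {m} {n} eq = ℕP.≤ᵇ⇒≤ m n (subst T (sym eq) _)
... | true  | false = refl
... | false | true  = refl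
... | false | false = ⊥-elim (ℕP.<-asym (≤ᵇ-false a b a≤b) (≤ᵇ-false b a b≤a))
  where
  ≤ᵇ-false : ∀ m n → (m ≤ᵇ n) ≡ false → n < m
  ≤ᵇ-false m n eq = ℕP.≰⇒> (λ m≤n → subst T eq (ℕP.≤⇒≤ᵇ m≤n))

Orients : Arc → Arc → Set
Orients e a = a ≡ e ⊎ a ≡ swap e

norm-orients : ∀ {e a} → Orients e a → norm a ≡ norm e
norm-orients (inj₁ refl) = refl
norm-orients (inj₂ refl) = norm-swap _

norm⇒orients : ∀ e a → norm a ≡ norm e → Orients e a
norm⇒orients (a , b) (c , d) eq with a ≤ᵇ b | c ≤ᵇ d
... | true  | true  = inj₁ eq
... | true  | false = inj₂ (cong swap eq)
... | false | true  = inj₂ eq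
... | false | false = inj₁ (cong swap eq)

norm⇒SameEnds : ∀ e f → norm e ≡ norm f → SameEnds e f
norm⇒SameEnds e f eq = norm⇒orients f e eq

orientation⇒norm : ∀ {E D} → Pointwise Orients E D → map norm D ≡ map norm E
orientation⇒norm []         = refl
orientation⇒norm (o ∷ os) = cong₂ _∷_ (norm-orients o) (orientation⇒norm os)

norm⇒orientation : ∀ E D → map norm D ≡ map norm E → Pointwise Orients E D
norm⇒orientation []       []       _  = []
norm⇒orientation (e ∷ E) (a ∷ D) eq = norm⇒orients e a (proj₁ (∷-injective eq)) ∷ norm⇒orientation E D (proj₂ (∷-injective eq))

unique-norm : ∀ E → AllPairs (λ e f → ¬ SameEnds e f) E → Unique (map norm E)
unique-norm E distinct = AllPairs.map⁺ (AllPairs.map (λ {e} {f} ¬same eq → ¬same (norm⇒SameEnds e f eq)) distinct)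

Incident : ℕ → Arc → Set
Incident v e = proj₁ e ≡ v ⊎ proj₂ e ≡ v

incident? : ∀ v → Decidable (Incident v)
incident? v e = (proj₁ e ℕ.≟ v) ⊎-dec (proj₂ e ℕ.≟ v)

-- the number of arcs of L at v; deg G v = incidence v (edges G)
incidence : ℕ → List Arc → ℕ
incidence v L = length (filter (incident? v) L)

orients-incident : ∀ {v e a} → Orients e a → Incident v e ⇔ Incident v a
orients-incident (inj₁ refl) = mk⇔ (λ i → i) (λ i → i)
orients-incident (inj₂ refl) = mk⇔ flip flip
  where
  flip : ∀ {A B : Set} → A ⊎ B → B ⊎ A
  flip (inj₁ a) = inj₂ a
  flip (inj₂ b) = inj₁ b

orientation-avoids : ∀ {v E D} → Pointwise Orients E D → All (Avoids v) E → All (Avoids v) D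
orientation-avoids []               []                         = []
orientation-avoids (inj₁ refl ∷ os) (avoid ∷ avoids)           = avoid ∷ orientation-avoids os avoids
orientation-avoids (inj₂ refl ∷ os) ((a≢v , b≢v) ∷ avoids) = (b≢v , a≢v) ∷ orientation-avoids os avoids

orientation-within : ∀ {m E D} → Pointwise Orients E D → All (Within m) E → All (Within m) D
orientation-within []               []                   = []
orientation-within (inj₁ refl ∷ os) (w ∷ ws)             = w ∷ orientation-within os ws
orientation-within (inj₂ refl ∷ os) ((a< , b<) ∷ ws) = (b< , a<) ∷ orientation-within os ws

module _ {A : Set} {P : A → Set} (P? : Decidable P) where

  length-filter-pointwise : ∀ {R : A → A → Set} {xs ys} → Pointwise R xs ys → (∀ {x y} → R x y → P x ⇔ P y) →
    length (filter P? xs) ≡ length (filter P? ys)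
  length-filter-pointwise [] _ = refl
  length-filter-pointwise {xs = x ∷ xs} {y ∷ ys} (r ∷ rs) P-resp with P? x | P? y
  ... | yes _  | yes _  = cong suc (length-filter-pointwise rs P-resp)
  ... | no _   | no _   = length-filter-pointwise rs P-resp
  ... | yes px | no ¬py = ⊥-elim (¬py (Equivalence.to (P-resp r) px))
  ... | no ¬px | yes py = ⊥-elim (¬px (Equivalence.from (P-resp r) py))

  length-filter-↭ : ∀ {xs ys} → xs ↭ ys → length (filter P? xs) ≡ length (filter P? ys)
  length-filter-↭ p = Perm.↭-length (Perm.filter-↭ P? p)

-- Transfer along an isomorphism.  A bounded orientation of G with
-- non-zero signed count yields one of any isomorphic simple graph H.

Bounded : Graph → (ℕ → ℕ) → List Arc → Set
Bounded G h D = All (λ v → outdeg D v ℕ.+ h v ℕ.+ 1 ≤ deg G v) (upTo (n G))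

Witness : Graph → (ℕ → ℕ) → List Arc → Set
Witness G h D = IsOrientation G D × Bounded G h D × σ (n G) (λ _ → + 0) (negW D) ≢ + 0

hx-self : ∀ x → hx x x ≡ 1
hx-self x with x ℕ.≡ᵇ x | ℕP.≡⇒≡ᵇ x x refl
... | true | _ = refl

hx-other : ∀ {x v} → v ≢ x → hx x v ≡ 0
hx-other {x} {v} v≢x with v ℕ.≡ᵇ x | ℕP.≡ᵇ⇒≡ v x
... | true  | v≡x = ⊥-elim (v≢x (v≡x _))
... | false | _   = refl

module Transfer (G H : Graph) (x y : ℕ) (G-simple : Simple G) (H-simple : Simple H) (iso : IsoAt G x H y) where
  open IsoAt iso

  f-inj : ∀ u v → u < n G → v < n G → f u ≡ f v → u ≡ v
  f-inj u v u<n v<n eq = trans (sym (gf u u<n)) (trans (cong g eq) (gf v v<n))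

  G-within : All (Within (n G)) (edges G)
  G-within = proj₁ G-simple

  H-within : All (Within (n H)) (edges H)
  H-within = proj₁ H-simple

  relabel-SameEnds : ∀ e e' → Within (n G) e → Within (n G) e' →
                     SameEnds (relabelArc f e) (relabelArc f e') → SameEnds e e'
  relabel-SameEnds (a , b) (c , d) (a< , b<) (c< , d<) (inj₁ eq) =
    inj₁ (cong₂ _,_ (f-inj a c a< c< (cong proj₁ eq)) (f-inj b d b< d< (cong proj₂ eq)))
  relabel-SameEnds (a , b) (c , d) (a< , b<) (c< , d<) (inj₂ eq) =
    inj₂ (cong₂ _,_ (f-inj a d a< d< (cong proj₁ eq)) (f-inj b c b< c< (cong proj₂ eq)))

  relabel-distinct : ∀ E → All (Within (n G)) E → AllPairs (λ e e' → ¬ SameEnds e e') E →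
                     AllPairs (λ e e' → ¬ SameEnds e e') (map (relabelArc f) E)
  relabel-distinct [] _ _ = []
  relabel-distinct (e ∷ E) (e-within ∷ E-within) (e-fresh ∷ E-distinct) =
    fresh E E-within e-fresh ∷ relabel-distinct E E-within E-distinct
    where
    fresh : ∀ E → All (Within (n G)) E → All (λ e' → ¬ SameEnds e e') E →
            All (λ e' → ¬ SameEnds (relabelArc f e) e') (map (relabelArc f) E)
    fresh [] _ _ = []
    fresh (e' ∷ E) (w ∷ ws) (¬same ∷ ¬sames) =
      (λ same → ¬same (relabel-SameEnds e e' e-within w same)) ∷ fresh E ws ¬sames

  image-set : map norm (map (relabelArc f) (edges G)) ∼[ set ] map norm (edges H)
  image-set = mk⇔ to from
    where
    to : ∀ {p} → p ∈ map norm (map (relabelArc f) (edges G)) → p ∈ map norm (edges H)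
    to p∈ with ∈-map⁻ norm p∈
    ... | _ , m∈ , refl with ∈-map⁻ (relabelArc f) m∈
    ...   | (u , v) , uv∈G , refl with All.lookup G-within uv∈G
    ...     | (u< , v<) with Equivalence.to (adj u v u< v<) (inj₁ uv∈G)
    ...       | inj₁ fuv∈H = ∈-map⁺ norm fuv∈H
    ...       | inj₂ fvu∈H = subst (_∈ map norm (edges H)) (norm-swap (f u , f v)) (∈-map⁺ norm fvu∈H)
    from : ∀ {p} → p ∈ map norm (edges H) → p ∈ map norm (map (relabelArc f) (edges G))
    from p∈ with ∈-map⁻ norm p∈
    ... | (a , b) , ab∈H , refl with All.lookup H-within ab∈H
    ...   | (a< , b<) with Equivalence.from (adj (g a) (g b) (g< a a<) (g< b b<))
                            (subst₂ (Adj H) (sym (fg a a<)) (sym (fg b b<)) (inj₁ ab∈H))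
    ...     | inj₁ gab∈G = subst (λ q → norm q ∈ _) fg-ab (∈-map⁺ norm (∈-map⁺ (relabelArc f) gab∈G))
      where fg-ab = cong₂ _,_ (fg a a<) (fg b b<)
    ...     | inj₂ gba∈G = subst (_∈ _) (trans (norm-swap (f (g a) , f (g b))) (cong norm fg-ab))
                             (∈-map⁺ norm (∈-map⁺ (relabelArc f) gba∈G))
      where fg-ab = cong₂ _,_ (fg a a<) (fg b b<)

  -- the normal forms of the relabelled edges of G are a permutation of those of H,
  -- both lists being duplicate-free
  image↭ : map norm (map (relabelArc f) (edges G)) ↭ map norm (edges H)
  image↭ = ∼bag⇒↭ (unique∧set⇒bag
    (unique-norm _ (relabel-distinct (edges G) G-within (proj₂ (proj₂ G-simple))))
    (unique-norm _ (proj₂ (proj₂ H-simple)))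
    image-set)

  relabel-orientation : ∀ {E D} → Pointwise Orients E D → Pointwise Orients (map (relabelArc f) E) (map (relabelArc f) D)
  relabel-orientation []               = []
  relabel-orientation (inj₁ refl ∷ os) = inj₁ refl ∷ relabel-orientation os
  relabel-orientation (inj₂ refl ∷ os) = inj₂ refl ∷ relabel-orientation os

  outdeg-relabel : ∀ D v → All (Within (n G)) D → v < n G → outdeg (map (relabelArc f) D) (f v) ≡ outdeg D v
  outdeg-relabel D v D-within v<n =
    trans (length-filter-map (λ a → proj₁ a ℕ.≟ f v) (relabelArc f) D)
      (length-filter-cong _ _ D D-within (λ { (a , b) (a< , _) eq → f-inj a v a< v<n eq }) (λ { _ _ eq → cong f eq }))

  incidence-relabel : ∀ D v → All (Within (n G)) D → v < n G → incidence (f v) (map (relabelArc f) D) ≡ incidence v D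
  incidence-relabel D v D-within v<n =
    trans (length-filter-map (incident? (f v)) (relabelArc f) D)
      (length-filter-cong _ _ D D-within
        (λ { (a , b) (a< , b<) (inj₁ eq) → inj₁ (f-inj a v a< v<n eq) ; (a , b) (a< , b<) (inj₂ eq) → inj₂ (f-inj b v b< v<n eq) })
        (λ { _ _ (inj₁ eq) → inj₁ (cong f eq) ; _ _ (inj₂ eq) → inj₂ (cong f eq) }))

  hx-relabel : ∀ v → v < n G → hx y (f v) ≡ hx x v
  hx-relabel v v<n with v ℕ.≟ x
  ... | yes refl = trans (cong (hx y) fx) (trans (hx-self y) (sym (hx-self v)))
  ... | no v≢x   = trans (hx-other (λ eq → v≢x (f-inj v x v<n x< (trans eq (sym fx))))) (sym (hx-other v≢x))

  transfer : IsAT G (hx x) → Σ (List Arc) (Witness H (hx y))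
  transfer (D , D-orients , EE≢EO , D-bounded) = D' , D'-orients , D'-bounded , D'-σ≢0
    where
    D-within : All (Within (n G)) D
    D-within = orientation-within D-orients G-within
    Df : List Arc
    Df = map (relabelArc f) D
    -- reorder the relabelled orientation to follow the edge order of H
    lifted : Σ (List Arc) λ D' → map norm (edges H) ≡ map norm D' × Df ↭ D'
    lifted = Perm.↭-map-inv norm (subst (_↭ map norm (edges H))
               (sym (orientation⇒norm (relabel-orientation D-orients))) image↭)
    D' : List Arc
    D' = proj₁ lifted
    Df↭D' : Df ↭ D'
    Df↭D' = proj₂ (proj₂ lifted)
    D'-orients : IsOrientation H D'
    D'-orients = norm⇒orientation (edges H) D' (sym (proj₁ (proj₂ lifted)))
    D'-σ≢0 : σ (n H) (λ _ → + 0) (negW D') ≢ + 0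
    D'-σ≢0 σ≡0 = EE≢EO⇒σ≢0 (n G) D EE≢EO (begin
      σ (n G) (λ _ → + 0) (negW D)                          ≡⟨ σ-relabel (negW D) _ _ (negW-within (n G) D D-within) (λ _ _ → refl) ⟨
      σ (n H) (λ _ → + 0) (map (relabelW f) (negW D))       ≡⟨ cong (σ (n H) (λ _ → + 0)) (negW-relabel D) ⟩
      σ (n H) (λ _ → + 0) (negW Df)                         ≡⟨ σ-perm (n H) (Perm.map⁺ _ Df↭D') (λ _ → + 0) ⟩
      σ (n H) (λ _ → + 0) (negW D')                         ≡⟨ σ≡0 ⟩
      + 0                                                   ∎)
      where
      open ≡-Reasoning
      open Relabel (n G) (n H) f g f< g< fg f-inj
      negW-relabel : ∀ D → map (relabelW f) (negW D) ≡ negW (map (relabelArc f) D)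
      negW-relabel []      = refl
      negW-relabel (_ ∷ D) = cong (_ ∷_) (negW-relabel D)
    degree : ∀ v → v < n G → deg H (f v) ≡ deg G v
    degree v v<n = begin
      incidence (f v) (edges H)  ≡⟨ length-filter-pointwise (incident? (f v)) D'-orients orients-incident ⟩
      incidence (f v) D'         ≡⟨ length-filter-↭ (incident? (f v)) Df↭D' ⟨
      incidence (f v) Df         ≡⟨ incidence-relabel D v D-within v<n ⟩
      incidence v D              ≡⟨ length-filter-pointwise (incident? v) D-orients orients-incident ⟨
      incidence v (edges G)      ∎
      where open ≡-Reasoning
    D'-bounded : Bounded H (hx y) D'
    D'-bounded = ⇒All< (n H) λ w w<n → subst (λ u → outdeg D' u ℕ.+ hx y u ℕ.+ 1 ≤ deg H u) (fg w w<n)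
      (bound-at (g w) (g< w w<n))
      where
      bound-at : ∀ v → v < n G → outdeg D' (f v) ℕ.+ hx y (f v) ℕ.+ 1 ≤ deg H (f v)
      bound-at v v<n rewrite hx-relabel v v<n | degree v v<n
        | sym (length-filter-↭ (λ a → proj₁ a ℕ.≟ f v) Df↭D') | outdeg-relabel D v D-within v<n
        = All<⇒ (n G) D-bounded v v<n

-- Subdivided paths.  pathE u s k t is the path from u to t whose k
-- internal vertices are s, s+1, ..., s+k-1, all larger than u and t.

Interior : ℕ → ℕ → ℕ → Set
Interior s k v = s ≤ v × v < s ℕ.+ k

interior-first : ∀ s k → Interior s (suc k) s
interior-first s k = ℕP.≤-refl , ℕP.m<m+n s (s≤s z≤n)

interior-rest : ∀ s k v → Interior (suc s) k v → Interior s (suc k) v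
interior-rest s k v (s<v , v<) = ℕP.<⇒≤ s<v , subst (v <_) (sym (ℕP.+-suc s k)) v<

interior-split : ∀ s k v → Interior s (suc k) v → v ≢ s → Interior (suc s) k v
interior-split s k v (s≤v , v<) v≢s = ℕP.≤∧≢⇒< s≤v (λ eq → v≢s (sym eq)) , subst (v <_) (ℕP.+-suc s k) v<

record Ends (u s t : ℕ) : Set where
  field
    u<s : u < s
    t<s : t < s
    u≢t : u ≢ t

ends-rest : ∀ {u s t} → Ends u s t → Ends s (suc s) t
ends-rest e = record { u<s = ℕP.n<1+n _ ; t<s = ℕP.m<n⇒m<1+n (Ends.t<s e) ; u≢t = λ eq → ℕP.<-irrefl (sym eq) (Ends.t<s e) }

orientation-misses : ∀ k u s t Q → Pointwise Orients (pathE u s k t) Q →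
  ∀ v → v ≢ u → v ≢ t → ¬ Interior s k v → All (Avoids v) Q
orientation-misses zero u s t (_ ∷ []) (inj₁ refl ∷ []) v v≢u v≢t _ = ((λ eq → v≢u (sym eq)) , (λ eq → v≢t (sym eq))) ∷ []
orientation-misses zero u s t (_ ∷ []) (inj₂ refl ∷ []) v v≢u v≢t _ = ((λ eq → v≢t (sym eq)) , (λ eq → v≢u (sym eq))) ∷ []
orientation-misses (suc k) u s t (a ∷ Q) (o ∷ os) v v≢u v≢t v∉ =
  first o ∷ orientation-misses k s (suc s) t Q os v v≢s v≢t (λ v∈ → v∉ (interior-rest s k v v∈))
  where
  v≢s : v ≢ s
  v≢s refl = v∉ (interior-first s k)
  first : ∀ {a} → Orients (u , s) a → Avoids v a
  first (inj₁ refl) = (λ eq → v≢u (sym eq)) , (λ eq → v≢s (sym eq))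
  first (inj₂ refl) = (λ eq → v≢s (sym eq)) , (λ eq → v≢u (sym eq))

misses-negW : ∀ v Q → All (Avoids v) Q → Misses v (negW Q)
misses-negW v []      []       = []
misses-negW v (_ ∷ Q) (a ∷ as) = a ∷ misses-negW v Q as

outdeg-avoid : ∀ v Q → All (Avoids v) Q → outdeg Q v ≡ 0
outdeg-avoid v Q avoid = cong length (filter-none (λ a → proj₁ a ℕ.≟ v) (All.map proj₁ avoid))

outdeg-∷-self : ∀ v b Q → outdeg ((v , b) ∷ Q) v ≡ suc (outdeg Q v)
outdeg-∷-self v b Q = cong length (filter-accept (λ a → proj₁ a ℕ.≟ v) refl)

outdeg-∷-other : ∀ a b v Q → a ≢ v → outdeg ((a , b) ∷ Q) v ≡ outdeg Q v
outdeg-∷-other a b v Q a≢v = cong length (filter-reject (λ a → proj₁ a ℕ.≟ v) a≢v)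

outdeg-∷-≤ : ∀ a Q v → outdeg Q v ≤ outdeg (a ∷ Q) v
outdeg-∷-≤ (a , b) Q v with a ℕ.≟ v
... | yes refl rewrite outdeg-∷-self a b Q = ℕP.n≤1+n _
... | no a≢v   rewrite outdeg-∷-other a b v Q a≢v = ℕP.≤-refl

-- If every interior vertex of an oriented path has
-- outdegree at most 1, then either the path is directed (from u to t or
-- from t to u) or some interior vertex is a sink.  Inside σ, with the
-- demand zero on the interior, a directed path of length k+1 acts as a
-- single arc of weight (-1)^(k+1), and a path with a sink acts as nothing.

data Shape : Set where
  forward backward blocked : Shape

outAtStart : Shape → ℕ
outAtStart forward  = 1
outAtStart backward = 0
outAtStart blocked  = 1

outAtEnd : Shape → ℕ
outAtEnd forward  = 0
outAtEnd backward = 1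
outAtEnd blocked  = 1

reduced : ℕ → ℕ → Shape → ℤ → List WArc
reduced u t forward  w = ((u , t) , w) ∷ []
reduced u t backward w = ((t , u) , w) ∷ []
reduced u t blocked  w = []

-- (-1)^(k+1), the weight of a directed path with k interior vertices
pathSign : ℕ → ℤ
pathSign zero    = -[1+ 0 ]
pathSign (suc k) = -[1+ 0 ] ℤ.* pathSign k

Reduces : ℕ → ℕ → List Arc → List WArc → Set
Reduces s k Q C = ∀ n β R → s ℕ.+ k ≤ n → ZeroOn (Interior s k) β → MissesAll (Interior s k) R →
                  σ n β (negW Q ++ R) ≡ σ n β (C ++ R)

record Reduction (u s k t : ℕ) (Q : List Arc) : Set where
  field
    shape      : Shape
    out-start  : outdeg Q u ≡ outAtStart shape
    out-end    : outdeg Q t ≡ outAtEnd shape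
    reduces    : Reduces s k Q (reduced u t shape (pathSign k))

module Extend (k u s t : ℕ) (Q : List Arc) (os : Pointwise Orients (pathE s (suc s) k t) Q) (ends : Ends u s t) where
  open Ends ends

  u≢s : u ≢ s
  u≢s eq = ℕP.<-irrefl eq u<s

  t≢s : t ≢ s
  t≢s eq = ℕP.<-irrefl eq t<s

  rest-at-u : outdeg Q u ≡ 0
  rest-at-u = outdeg-avoid u Q (orientation-misses k s (suc s) t Q os u u≢s u≢t (λ v∈ → ℕP.<-asym u<s (proj₁ v∈)))

  first-avoids : ∀ v → Interior (suc s) k v → Avoids v (u , s)
  first-avoids v (s<v , _) = (λ eq → ℕP.<-asym (subst (_< s) eq u<s) s<v) , (λ eq → ℕP.<-irrefl eq s<v)

  first-avoids' : ∀ v → Interior (suc s) k v → Avoids v (s , u)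
  first-avoids' v v∈ = proj₂ (first-avoids v v∈) , proj₁ (first-avoids v v∈)

  s<n : ∀ n → s ℕ.+ suc k ≤ n → s < n
  s<n n le = ℕP.<-≤-trans (ℕP.m<m+n s (s≤s z≤n)) le

  prepend : ∀ a C → (∀ v → Interior (suc s) k v → Avoids v a) → Reduces (suc s) k Q C →
            ∀ n β R → s ℕ.+ suc k ≤ n → ZeroOn (Interior s (suc k)) β → MissesAll (Interior s (suc k)) R →
            σ n β ((a , -[1+ 0 ]) ∷ (negW Q ++ R)) ≡ σ n β ((a , -[1+ 0 ]) ∷ (C ++ R))
  prepend a C a-avoids rest n β R le β0 R-misses =
    cong₂ (λ p q → p ℤ.+ -[1+ 0 ] ℤ.* q) (rest n β R le' β0' R-misses')
      (rest n (β ⊖ a) R le' (λ v v∈ → trans (⊖-avoid β a v (a-avoids v v∈)) (β0' v v∈)) R-misses')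
    where
    le' : suc s ℕ.+ k ≤ n
    le' = subst (_≤ n) (ℕP.+-suc s k) le
    β0' : ZeroOn (Interior (suc s) k) β
    β0' v v∈ = β0 v (interior-rest s k v v∈)
    R-misses' : MissesAll (Interior (suc s) k) R
    R-misses' v v∈ = R-misses v (interior-rest s k v v∈)

  first-enters : flow (u , s) s ≡ + 1
  first-enters rewrite ind-self s | ind-other u≢s = refl

  start-forward : outdeg ((u , s) ∷ Q) u ≡ 1
  start-forward = trans (outdeg-∷-self u s Q) (cong suc rest-at-u)

  extend-forward : Reduction s (suc s) k t Q → Reduction u s (suc k) t ((u , s) ∷ Q)
  extend-forward r with Reduction.shape r | Reduction.out-end r | Reduction.reduces r
  ... | forward | out-t | rest = record
    { shape = forward ; out-start = start-forward ; out-end = trans (outdeg-∷-other u s t Q u≢t) out-t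
    ; reduces = λ n β R le β0 R-misses → trans (prepend (u , s) (reduced s t forward (pathSign k)) first-avoids rest n β R le β0 R-misses)
        (σ-contract n R β u s t -[1+ 0 ] (pathSign k) (s<n n le) (R-misses s (interior-first s k))
          (β0 s (interior-first s k)) u≢s t≢s) }
  ... | backward | out-t | rest = record
    { shape = blocked ; out-start = start-forward ; out-end = trans (outdeg-∷-other u s t Q u≢t) out-t
    ; reduces = λ n β R le β0 R-misses → trans (prepend (u , s) (reduced s t backward (pathSign k)) first-avoids rest n β R le β0 R-misses)
        (σ-sink n R β u t s -[1+ 0 ] (pathSign k) (s<n n le) (R-misses s (interior-first s k))
          (β0 s (interior-first s k)) u≢s t≢s) }
  ... | blocked | out-t | rest = record
    { shape = blocked ; out-start = start-forward ; out-end = trans (outdeg-∷-other u s t Q u≢t) out-t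
    ; reduces = λ n β R le β0 R-misses → trans (prepend (u , s) [] first-avoids rest n β R le β0 R-misses)
        (σ-pendant n R β (u , s) -[1+ 0 ] s (s<n n le) (R-misses s (interior-first s k))
          (β0 s (interior-first s k)) (λ eq → +1≢0 (trans (sym first-enters) eq))) }
    where
    +1≢0 : + 1 ≢ + 0
    +1≢0 ()

  -- first arc s → u: then s has no other out-arc, so the rest runs t → s
  extend-backward : suc (outdeg Q s) ≤ 1 → Reduction s (suc s) k t Q → Reduction u s (suc k) t ((s , u) ∷ Q)
  extend-backward s-bound r with Reduction.shape r | Reduction.out-start r | Reduction.out-end r | Reduction.reduces r
  ... | forward | out-s | _ | _ = ⊥-elim (ℕP.<-irrefl refl (subst (λ m → suc m ≤ 1) out-s s-bound))
  ... | blocked | out-s | _ | _ = ⊥-elim (ℕP.<-irrefl refl (subst (λ m → suc m ≤ 1) out-s s-bound))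
  ... | backward | _ | out-t | rest = record
    { shape = backward
    ; out-start = trans (outdeg-∷-other s u u Q (λ eq → u≢s (sym eq))) rest-at-u
    ; out-end = trans (outdeg-∷-other s u t Q (λ eq → t≢s (sym eq))) out-t
    ; reduces = λ n β R le β0 R-misses → begin
        σ n β (((s , u) , -[1+ 0 ]) ∷ (negW Q ++ R))
          ≡⟨ prepend (s , u) (reduced s t backward (pathSign k)) first-avoids' rest n β R le β0 R-misses ⟩
        σ n β (((s , u) , -[1+ 0 ]) ∷ ((t , s) , pathSign k) ∷ R)
          ≡⟨ σ-swap n β ((s , u) , -[1+ 0 ]) ((t , s) , pathSign k) R ⟩
        σ n β (((t , s) , pathSign k) ∷ ((s , u) , -[1+ 0 ]) ∷ R)
          ≡⟨ σ-contract n R β t s u (pathSign k) -[1+ 0 ] (s<n n le) (R-misses s (interior-first s k))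
               (β0 s (interior-first s k)) t≢s u≢s ⟩
        σ n β (((t , u) , pathSign k ℤ.* -[1+ 0 ]) ∷ R)
          ≡⟨ cong (λ w → σ n β (((t , u) , w) ∷ R)) (ℤP.*-comm (pathSign k) -[1+ 0 ]) ⟩
        σ n β (((t , u) , pathSign (suc k)) ∷ R)
          ∎ }
    where open ≡-Reasoning

reduce-path : ∀ k u s t Q → Pointwise Orients (pathE u s k t) Q → Ends u s t →
              (∀ v → Interior s k v → outdeg Q v ≤ 1) → Reduction u s k t Q
reduce-path zero u s t (_ ∷ []) (inj₁ refl ∷ []) ends _ = record
  { shape = forward ; out-start = outdeg-∷-self u t []
  ; out-end = outdeg-∷-other u t t [] (Ends.u≢t ends) ; reduces = λ _ _ _ _ _ _ → refl }
reduce-path zero u s t (_ ∷ []) (inj₂ refl ∷ []) ends _ = record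
  { shape = backward ; out-start = outdeg-∷-other t u u [] (λ eq → Ends.u≢t ends (sym eq))
  ; out-end = outdeg-∷-self t u [] ; reduces = λ _ _ _ _ _ _ → refl }
reduce-path (suc k) u s t (_ ∷ Q) (inj₁ refl ∷ os) ends bounded =
  Extend.extend-forward k u s t Q os ends
    (reduce-path k s (suc s) t Q os (ends-rest ends)
      (λ v v∈ → ℕP.≤-trans (outdeg-∷-≤ (u , s) Q v) (bounded v (interior-rest s k v v∈))))
reduce-path (suc k) u s t (_ ∷ Q) (inj₂ refl ∷ os) ends bounded =
  Extend.extend-backward k u s t Q os ends (subst (_≤ 1) (outdeg-∷-self s u Q) (bounded s (interior-first s k)))
    (reduce-path k s (suc s) t Q os (ends-rest ends)
      (λ v v∈ → ℕP.≤-trans (outdeg-∷-≤ (s , u) Q v) (bounded v (interior-rest s k v v∈))))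

avoids⇒¬incident : ∀ {v a} → Avoids v a → ¬ Incident v a
avoids⇒¬incident (a≢v , _) (inj₁ a≡v) = a≢v a≡v
avoids⇒¬incident (_ , b≢v) (inj₂ b≡v) = b≢v b≡v

incidence-avoid : ∀ v L → All (Avoids v) L → incidence v L ≡ 0
incidence-avoid v L avoid = cong length (filter-none (incident? v) (All.map avoids⇒¬incident avoid))

incidence-∷-yes : ∀ v a L → Incident v a → incidence v (a ∷ L) ≡ suc (incidence v L)
incidence-∷-yes v a L inc = cong length (filter-accept (incident? v) inc)

incidence-∷-no : ∀ v a L → Avoids v a → incidence v (a ∷ L) ≡ incidence v L
incidence-∷-no v a L avoid = cong length (filter-reject (incident? v) (avoids⇒¬incident avoid))

path-orients-itself : ∀ k u s t → Pointwise Orients (pathE u s k t) (pathE u s k t)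
path-orients-itself k u s t = Pointwise.refl (inj₁ refl)

incidence-off-path : ∀ k u s t v → v ≢ u → v ≢ t → ¬ Interior s k v → incidence v (pathE u s k t) ≡ 0
incidence-off-path k u s t v v≢u v≢t v∉ =
  incidence-avoid v _ (orientation-misses k u s t _ (path-orients-itself k u s t) v v≢u v≢t v∉)

incidence-start : ∀ k u s t → Ends u s t → incidence u (pathE u s k t) ≡ 1
incidence-start zero    u s t ends = incidence-∷-yes u (u , t) [] (inj₁ refl)
incidence-start (suc k) u s t ends =
  trans (incidence-∷-yes u (u , s) _ (inj₁ refl))
    (cong suc (incidence-off-path k s (suc s) t u (λ eq → ℕP.<-irrefl eq (Ends.u<s ends)) (Ends.u≢t ends)
      (λ u∈ → ℕP.<-asym (Ends.u<s ends) (proj₁ u∈))))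

incidence-end : ∀ k u s t → Ends u s t → incidence t (pathE u s k t) ≡ 1
incidence-end zero    u s t ends = incidence-∷-yes t (u , t) [] (inj₂ refl)
incidence-end (suc k) u s t ends =
  trans (incidence-∷-no t (u , s) _ (Ends.u≢t ends , λ eq → ℕP.<-irrefl (sym eq) (Ends.t<s ends)))
    (incidence-end k s (suc s) t (ends-rest ends))

incidence-interior : ∀ k u s t → Ends u s t → ∀ v → Interior s k v → incidence v (pathE u s k t) ≡ 2
incidence-interior zero u s t ends v (s≤v , v<s+0) =
  ⊥-elim (ℕP.<-irrefl refl (ℕP.<-≤-trans v<s+0 (subst (_≤ v) (sym (ℕP.+-identityʳ s)) s≤v)))
incidence-interior (suc k) u s t ends v v∈ with v ℕ.≟ s
... | yes refl = trans (incidence-∷-yes v (u , v) _ (inj₂ refl)) (cong suc (incidence-start k v (suc v) t (ends-rest ends)))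
... | no v≢s   =
  trans (incidence-∷-no v (u , s) _ ((λ eq → ℕP.<-irrefl eq (ℕP.<-≤-trans (Ends.u<s ends) (proj₁ v∈))) , (λ eq → v≢s (sym eq))))
    (incidence-interior k s (suc s) t (ends-rest ends) v (interior-split s k v v∈ v≢s))

orientationsOf : List Arc → List (List Arc)
orientationsOf []      = [] ∷ []
orientationsOf (e ∷ E) = map (e ∷_) (orientationsOf E) ++ map (swap e ∷_) (orientationsOf E)

orientation∈ : ∀ E D → Pointwise Orients E D → D ∈ orientationsOf E
orientation∈ []      []      []                = here refl
orientation∈ (e ∷ E) (_ ∷ D) (inj₁ refl ∷ os) = ∈-++⁺ˡ (∈-map⁺ (e ∷_) (orientation∈ E D os))
orientation∈ (e ∷ E) (_ ∷ D) (inj₂ refl ∷ os) = ∈-++⁺ʳ _ (∈-map⁺ (swap e ∷_) (orientation∈ E D os))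

bounded? : ∀ G h D → Dec (Bounded G h D)
bounded? G h D = All.all? (λ v → outdeg D v ℕ.+ h v ℕ.+ 1 ≤? deg G v) (upTo (n G))

-- Once every subdivided path has been reduced, what
-- remains lives on the four vertices 0, 1, 2, 3 of K4: an orientation T
-- of the triangle 123 and, for each i, the reduction of the path from 0
-- to i, all paths carrying the same weight w.

triangle : List Arc
triangle = (1 , 2) ∷ (1 , 3) ∷ (2 , 3) ∷ []

shapes : List Shape
shapes = forward ∷ backward ∷ blocked ∷ []

shape∈ : ∀ sh → sh ∈ shapes
shape∈ forward  = here refl
shape∈ backward = there (here refl)
shape∈ blocked  = there (there (here refl))

signs : List ℤ
signs = -[1+ 0 ] ∷ + 1 ∷ []

coreArcs : List Arc → Shape → Shape → Shape → ℤ → List WArc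
coreArcs T sh₁ sh₂ sh₃ w = negW T ++ (reduced 0 1 sh₁ w ++ (reduced 0 2 sh₂ w ++ reduced 0 3 sh₃ w))

-- The outdegree bounds that the core inherits: vertex 0 has degree 3
-- and h = 1, so at most one path leaves it; vertex i has degree 3 and
-- h = 0, so at most two arcs leave it.
CoreBounded : List Arc → Shape → Shape → Shape → Set
CoreBounded T sh₁ sh₂ sh₃ =
  outAtStart sh₁ ℕ.+ (outAtStart sh₂ ℕ.+ outAtStart sh₃) ≤ 1
  × outdeg T 1 ℕ.+ outAtEnd sh₁ ≤ 2
  × outdeg T 2 ℕ.+ outAtEnd sh₂ ≤ 2
  × outdeg T 3 ℕ.+ outAtEnd sh₃ ≤ 2

CoreVanishes : List Arc → Shape → Shape → Shape → ℤ → Set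
CoreVanishes T sh₁ sh₂ sh₃ w = CoreBounded T sh₁ sh₂ sh₃ → σ 4 (λ _ → + 0) (coreArcs T sh₁ sh₂ sh₃ w) ≡ + 0

core-vanishes? : ∀ T sh₁ sh₂ sh₃ w → Dec (CoreVanishes T sh₁ sh₂ sh₃ w)
core-vanishes? T sh₁ sh₂ sh₃ w =
  ((_ ≤? 1) ×-dec (_ ≤? 2) ×-dec (_ ≤? 2) ×-dec (_ ≤? 2)) →-dec (σ 4 (λ _ → + 0) (coreArcs T sh₁ sh₂ sh₃ w) ℤ.≟ + 0)

-- Checked by computation over all 8 · 27 · 2 cases.
core-table : All (λ T → All (λ sh₁ → All (λ sh₂ → All (λ sh₃ → All (λ w →
               CoreVanishes T sh₁ sh₂ sh₃ w) signs) shapes) shapes) shapes) (orientationsOf triangle)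
core-table = from-yes (All.all? (λ T → All.all? (λ sh₁ → All.all? (λ sh₂ → All.all? (λ sh₃ → All.all? (λ w →
               core-vanishes? T sh₁ sh₂ sh₃ w) signs) shapes) shapes) shapes) (orientationsOf triangle))

core-vanishes : ∀ T sh₁ sh₂ sh₃ w → Pointwise Orients triangle T → w ∈ signs → CoreVanishes T sh₁ sh₂ sh₃ w
core-vanishes T sh₁ sh₂ sh₃ w T-orients w∈ =
  All.lookup (All.lookup (All.lookup (All.lookup (All.lookup core-table
    (orientation∈ triangle T T-orients)) (shape∈ sh₁)) (shape∈ sh₂)) (shape∈ sh₃)) w∈

orientation-++ : ∀ E F {D} → Pointwise Orients (E ++ F) D →
  Σ (List Arc) λ D₁ → Σ (List Arc) λ D₂ → D ≡ D₁ ++ D₂ × Pointwise Orients E D₁ × Pointwise Orients F D₂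
orientation-++ []      F os = [] , _ , refl , [] , os
orientation-++ (e ∷ E) F (o ∷ os) with orientation-++ E F os
... | D₁ , D₂ , refl , os₁ , os₂ = _ ∷ D₁ , D₂ , refl , o ∷ os₁ , os₂

outdeg-++ : ∀ v A B → outdeg (A ++ B) v ≡ outdeg A v ℕ.+ outdeg B v
outdeg-++ v = length-filter-++ (λ a → proj₁ a ℕ.≟ v)

incidence-++ : ∀ v A B → incidence v (A ++ B) ≡ incidence v A ℕ.+ incidence v B
incidence-++ v = length-filter-++ (incident? v)

negW-++ : ∀ A B → negW (A ++ B) ≡ negW A ++ negW B
negW-++ = map-++ _

reduced-misses : ∀ v u t sh w → v ≢ u → v ≢ t → Misses v (reduced u t sh w)
reduced-misses v u t forward  w v≢u v≢t = ((λ eq → v≢u (sym eq)) , (λ eq → v≢t (sym eq))) ∷ []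
reduced-misses v u t backward w v≢u v≢t = ((λ eq → v≢t (sym eq)) , (λ eq → v≢u (sym eq))) ∷ []
reduced-misses v u t blocked  w v≢u v≢t = []

reduced-within : ∀ m u t sh w → u < m → t < m → All (λ p → Within m (proj₁ p)) (reduced u t sh w)
reduced-within m u t forward  w u<m t<m = (u<m , t<m) ∷ []
reduced-within m u t backward w u<m t<m = (t<m , u<m) ∷ []
reduced-within m u t blocked  w u<m t<m = []

reduce-in-context : ∀ {s k} Q C → Reduces s k Q C → ∀ n P R → s ℕ.+ k ≤ n →
  MissesAll (Interior s k) P → MissesAll (Interior s k) R →
  σ n (λ _ → + 0) (P ++ (negW Q ++ R)) ≡ σ n (λ _ → + 0) (P ++ (C ++ R))
reduce-in-context {s} {k} Q C red n P R le P-misses R-misses =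
  σ-prefix n (Interior s k) P _ _ P-misses (λ β β0 → red n β R le β0 R-misses) (λ _ → + 0) (λ _ _ → refl)

interiors-disjoint : ∀ {s k s' k' v} → s ℕ.+ k ≤ s' → Interior s k v → ¬ Interior s' k' v
interiors-disjoint le (_ , v<) (s'≤v , _) = ℕP.<-irrefl refl (ℕP.<-≤-trans v< (ℕP.≤-trans le s'≤v))

peel : ∀ m h d → m ℕ.+ h ℕ.+ 1 ≤ h ℕ.+ suc d → m ≤ d
peel m h d le = ℕP.≤-pred (ℕP.+-cancelˡ-≤ h (suc m) (suc d) (subst (_≤ h ℕ.+ suc d) (rearrange m h) le))
  where
  rearrange : ∀ m h → m ℕ.+ h ℕ.+ 1 ≡ h ℕ.+ suc m
  rearrange m h = trans (ℕP.+-comm (m ℕ.+ h) 1) (trans (cong suc (ℕP.+-comm m h)) (sym (ℕP.+-suc h m)))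

Quiet : List Arc → List Arc → ℕ → Set
Quiet Q P v = outdeg Q v ≡ 0 × incidence v P ≡ 0

path-off : ∀ {k s t Q} → Pointwise Orients (pathE 0 s k t) Q → ∀ v → v ≢ 0 → v ≢ t → ¬ Interior s k v →
           Quiet Q (pathE 0 s k t) v
path-off {k} {s} {t} {Q} os v v≢0 v≢t v∉ =
  outdeg-avoid v Q (orientation-misses k 0 s t Q os v v≢0 v≢t v∉) , incidence-off-path k 0 s t v v≢0 v≢t v∉

first-of₃ : ∀ {a b c x} → a ≡ x → b ≡ 0 → c ≡ 0 → a ℕ.+ (b ℕ.+ c) ≡ x
first-of₃ {x = x} refl refl refl = ℕP.+-identityʳ x

second-of₃ : ∀ {a b c x} → a ≡ 0 → b ≡ x → c ≡ 0 → a ℕ.+ (b ℕ.+ c) ≡ x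
second-of₃ {x = x} refl refl refl = ℕP.+-identityʳ x

third-of₃ : ∀ {a b c x} → a ≡ 0 → b ≡ 0 → c ≡ x → a ℕ.+ (b ℕ.+ c) ≡ x
third-of₃ refl refl refl = refl

module K4Sub (l₁ l₂ l₃ : ℕ) where

  -- the layout of K4sub: triangle on 1, 2, 3 and paths P₁, P₂, P₃ from 0
  -- to 1, 2, 3 with interiors [4, s₂), [s₂, s₃), [s₃, N)
  s₂ s₃ N : ℕ
  s₂ = 4 ℕ.+ l₁
  s₃ = 4 ℕ.+ l₁ ℕ.+ l₂
  N  = 4 ℕ.+ l₁ ℕ.+ l₂ ℕ.+ l₃

  P₁ P₂ P₃ : List Arc
  P₁ = pathE 0 4 l₁ 1
  P₂ = pathE 0 s₂ l₂ 2
  P₃ = pathE 0 s₃ l₃ 3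

  4≤s₂ : 4 ≤ s₂
  4≤s₂ = ℕP.m≤m+n 4 l₁
  s₂≤s₃ : s₂ ≤ s₃
  s₂≤s₃ = ℕP.m≤m+n s₂ l₂
  s₃≤N : s₃ ≤ N
  s₃≤N = ℕP.m≤m+n s₃ l₃
  4≤s₃ : 4 ≤ s₃
  4≤s₃ = ℕP.≤-trans 4≤s₂ s₂≤s₃
  4≤N : 4 ≤ N
  4≤N = ℕP.≤-trans 4≤s₃ s₃≤N

  1<4 : 1 < 4
  1<4 = s<s z<s
  2<4 : 2 < 4
  2<4 = s<s (s<s z<s)
  3<4 : 3 < 4
  3<4 = s<s (s<s (s<s z<s))

  low : ∀ {c s} → c < 4 → 4 ≤ s → c < s
  low c<4 4≤s = ℕP.<-≤-trans c<4 4≤s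

  ends₁ : Ends 0 4 1
  ends₁ = record { u<s = z<s ; t<s = 1<4 ; u≢t = λ () }
  ends₂ : Ends 0 s₂ 2
  ends₂ = record { u<s = low z<s 4≤s₂ ; t<s = low 2<4 4≤s₂ ; u≢t = λ () }
  ends₃ : Ends 0 s₃ 3
  ends₃ = record { u<s = low z<s 4≤s₃ ; t<s = low 3<4 4≤s₃ ; u≢t = λ () }

  big≢ : ∀ {v c} → 4 ≤ v → c < 4 → v ≢ c
  big≢ 4≤v c<4 refl = ℕP.<-irrefl refl (ℕP.<-≤-trans c<4 4≤v)

  triangle-avoids : ∀ v → 4 ≤ v ⊎ v ≡ 0 → All (Avoids v) triangle
  triangle-avoids v v-off = (≢v 1<4 z<s , ≢v 2<4 z<s) ∷ (≢v 1<4 z<s , ≢v 3<4 z<s) ∷ (≢v 2<4 z<s , ≢v 3<4 z<s) ∷ []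
    where
    ≢v : ∀ {c} → c < 4 → 0 < c → c ≢ v
    ≢v c<4 0<c eq = off v-off
      where
      off : 4 ≤ v ⊎ v ≡ 0 → ⊥
      off (inj₁ 4≤v) = big≢ 4≤v c<4 (sym eq)
      off (inj₂ refl) = ℕP.<-irrefl (sym eq) 0<c

  module Orientation (T Q₁ Q₂ Q₃ : List Arc) (T-os : Pointwise Orients triangle T)
    (os₁ : Pointwise Orients P₁ Q₁) (os₂ : Pointwise Orients P₂ Q₂) (os₃ : Pointwise Orients P₃ Q₃)
    (bounded : Bounded (K4sub l₁ l₂ l₃) (hx 0) (T ++ (Q₁ ++ (Q₂ ++ Q₃)))) where

    outdeg-sum incidence-sum : ℕ → ℕ
    outdeg-sum v = outdeg T v ℕ.+ (outdeg Q₁ v ℕ.+ (outdeg Q₂ v ℕ.+ outdeg Q₃ v))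
    incidence-sum v = incidence v triangle ℕ.+ (incidence v P₁ ℕ.+ (incidence v P₂ ℕ.+ incidence v P₃))

    local-bound : ∀ v x d → v < N → outdeg-sum v ≡ x → incidence-sum v ≡ hx 0 v ℕ.+ suc d → x ≤ d
    local-bound v x d v<N out≡ deg≡ = peel x (hx 0 v) d
      (subst₂ (λ o i → o ℕ.+ hx 0 v ℕ.+ 1 ≤ i) out-split deg-split (All<⇒ N bounded v v<N))
      where
      out-split : outdeg (T ++ (Q₁ ++ (Q₂ ++ Q₃))) v ≡ x
      out-split = trans (trans (outdeg-++ v T _) (cong (outdeg T v ℕ.+_) (trans (outdeg-++ v Q₁ _)
                    (cong (outdeg Q₁ v ℕ.+_) (outdeg-++ v Q₂ Q₃))))) out≡
      deg-split : deg (K4sub l₁ l₂ l₃) v ≡ hx 0 v ℕ.+ suc d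
      deg-split = trans (trans (incidence-++ v triangle _) (cong (incidence v triangle ℕ.+_) (trans (incidence-++ v P₁ _)
                    (cong (incidence v P₁ ℕ.+_) (incidence-++ v P₂ P₃))))) deg≡

    T-avoids : ∀ v → 4 ≤ v ⊎ v ≡ 0 → outdeg T v ≡ 0
    T-avoids v v-off = outdeg-avoid v T (orientation-avoids T-os (triangle-avoids v v-off))

    T-untouched : ∀ v → 4 ≤ v → incidence v triangle ≡ 0
    T-untouched v 4≤v = incidence-avoid v triangle (triangle-avoids v (inj₁ 4≤v))

    -- interior vertices have degree 2 and h = 0, hence outdegree at most 1
    interior-bound : ∀ v x → v < N → 4 ≤ v → outdeg-sum v ≡ x → incidence-sum v ≡ 2 → x ≤ 1
    interior-bound v x v<N 4≤v out≡ deg≡ =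
      local-bound v x 1 v<N out≡ (trans deg≡ (cong (ℕ._+ 2) (sym (hx-other (big≢ 4≤v z<s)))))

    interior₁ : ∀ v → Interior 4 l₁ v → outdeg Q₁ v ≤ 1
    interior₁ v v∈@(4≤v , v<s₂) = interior-bound v _ (ℕP.<-≤-trans v<s₂ (ℕP.≤-trans s₂≤s₃ s₃≤N)) 4≤v
      (cong₂ ℕ._+_ (T-avoids v (inj₁ 4≤v)) (first-of₃ refl (proj₁ off₂) (proj₁ off₃)))
      (cong₂ ℕ._+_ (T-untouched v 4≤v) (first-of₃ (incidence-interior l₁ 0 4 1 ends₁ v v∈) (proj₂ off₂) (proj₂ off₃)))
      where
      off₂ : Quiet Q₂ P₂ v
      off₂ = path-off os₂ v (big≢ 4≤v z<s) (big≢ 4≤v 2<4) (interiors-disjoint ℕP.≤-refl v∈)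
      off₃ : Quiet Q₃ P₃ v
      off₃ = path-off os₃ v (big≢ 4≤v z<s) (big≢ 4≤v 3<4) (interiors-disjoint s₂≤s₃ v∈)

    interior₂ : ∀ v → Interior s₂ l₂ v → outdeg Q₂ v ≤ 1
    interior₂ v v∈@(s₂≤v , v<s₃) = interior-bound v _ (ℕP.<-≤-trans v<s₃ s₃≤N) 4≤v
      (cong₂ ℕ._+_ (T-avoids v (inj₁ 4≤v)) (second-of₃ (proj₁ off₁) refl (proj₁ off₃)))
      (cong₂ ℕ._+_ (T-untouched v 4≤v) (second-of₃ (proj₂ off₁) (incidence-interior l₂ 0 s₂ 2 ends₂ v v∈) (proj₂ off₃)))
      where
      4≤v : 4 ≤ v
      4≤v = ℕP.≤-trans 4≤s₂ s₂≤v
      off₁ : Quiet Q₁ P₁ v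
      off₁ = path-off os₁ v (big≢ 4≤v z<s) (big≢ 4≤v 1<4) (λ v∈₁ → interiors-disjoint ℕP.≤-refl v∈₁ v∈)
      off₃ : Quiet Q₃ P₃ v
      off₃ = path-off os₃ v (big≢ 4≤v z<s) (big≢ 4≤v 3<4) (interiors-disjoint ℕP.≤-refl v∈)

    interior₃ : ∀ v → Interior s₃ l₃ v → outdeg Q₃ v ≤ 1
    interior₃ v v∈@(s₃≤v , v<N) = interior-bound v _ v<N 4≤v
      (cong₂ ℕ._+_ (T-avoids v (inj₁ 4≤v)) (third-of₃ (proj₁ off₁) (proj₁ off₂) refl))
      (cong₂ ℕ._+_ (T-untouched v 4≤v) (third-of₃ (proj₂ off₁) (proj₂ off₂) (incidence-interior l₃ 0 s₃ 3 ends₃ v v∈)))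
      where
      4≤v : 4 ≤ v
      4≤v = ℕP.≤-trans 4≤s₃ s₃≤v
      off₁ : Quiet Q₁ P₁ v
      off₁ = path-off os₁ v (big≢ 4≤v z<s) (big≢ 4≤v 1<4) (λ v∈₁ → interiors-disjoint s₂≤s₃ v∈₁ v∈)
      off₂ : Quiet Q₂ P₂ v
      off₂ = path-off os₂ v (big≢ 4≤v z<s) (big≢ 4≤v 2<4) (λ v∈₂ → interiors-disjoint ℕP.≤-refl v∈₂ v∈)

    r₁ : Reduction 0 4 l₁ 1 Q₁
    r₁ = reduce-path l₁ 0 4 1 Q₁ os₁ ends₁ interior₁
    r₂ : Reduction 0 s₂ l₂ 2 Q₂
    r₂ = reduce-path l₂ 0 s₂ 2 Q₂ os₂ ends₂ interior₂
    r₃ : Reduction 0 s₃ l₃ 3 Q₃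
    r₃ = reduce-path l₃ 0 s₃ 3 Q₃ os₃ ends₃ interior₃

    open Reduction r₁ renaming (shape to sh₁; out-start to start₁; out-end to end₁; reduces to reduces₁)
    open Reduction r₂ renaming (shape to sh₂; out-start to start₂; out-end to end₂; reduces to reduces₂)
    open Reduction r₃ renaming (shape to sh₃; out-start to start₃; out-end to end₃; reduces to reduces₃)

    core-bounded : CoreBounded T sh₁ sh₂ sh₃
    core-bounded = at-0 , at-1 , at-2 , at-3
      where
      low-off : ∀ {k s t Q} → Pointwise Orients (pathE 0 s k t) Q → 4 ≤ s → ∀ v → v < 4 → v ≢ 0 → v ≢ t →
                Quiet Q (pathE 0 s k t) v
      low-off os 4≤s v v<4 v≢0 v≢t = path-off os v v≢0 v≢t (λ v∈ → ℕP.<-irrefl refl (ℕP.<-≤-trans v<4 (ℕP.≤-trans 4≤s (proj₁ v∈))))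
      at-0 : outAtStart sh₁ ℕ.+ (outAtStart sh₂ ℕ.+ outAtStart sh₃) ≤ 1
      at-0 = local-bound 0 _ 1 (low z<s 4≤N)
        (cong₂ ℕ._+_ (T-avoids 0 (inj₂ refl)) (cong₂ ℕ._+_ start₁ (cong₂ ℕ._+_ start₂ start₃)))
        (cong₂ ℕ._+_ (incidence-avoid 0 triangle (triangle-avoids 0 (inj₂ refl))) (cong₂ ℕ._+_ (incidence-start l₁ 0 4 1 ends₁)
          (cong₂ ℕ._+_ (incidence-start l₂ 0 s₂ 2 ends₂) (incidence-start l₃ 0 s₃ 3 ends₃))))
      at-1 : outdeg T 1 ℕ.+ outAtEnd sh₁ ≤ 2
      at-1 = local-bound 1 _ 2 (low 1<4 4≤N)
        (cong (outdeg T 1 ℕ.+_) (first-of₃ end₁ (proj₁ off₂) (proj₁ off₃)))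
        (cong (incidence 1 triangle ℕ.+_) (first-of₃ (incidence-end l₁ 0 4 1 ends₁) (proj₂ off₂) (proj₂ off₃)))
        where
        off₂ : Quiet Q₂ P₂ 1
        off₂ = low-off os₂ 4≤s₂ 1 1<4 (λ ()) (λ ())
        off₃ : Quiet Q₃ P₃ 1
        off₃ = low-off os₃ 4≤s₃ 1 1<4 (λ ()) (λ ())
      at-2 : outdeg T 2 ℕ.+ outAtEnd sh₂ ≤ 2
      at-2 = local-bound 2 _ 2 (low 2<4 4≤N)
        (cong (outdeg T 2 ℕ.+_) (second-of₃ (proj₁ off₁) end₂ (proj₁ off₃)))
        (cong (incidence 2 triangle ℕ.+_) (second-of₃ (proj₂ off₁) (incidence-end l₂ 0 s₂ 2 ends₂) (proj₂ off₃)))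
        where
        off₁ : Quiet Q₁ P₁ 2
        off₁ = low-off os₁ ℕP.≤-refl 2 2<4 (λ ()) (λ ())
        off₃ : Quiet Q₃ P₃ 2
        off₃ = low-off os₃ 4≤s₃ 2 2<4 (λ ()) (λ ())
      at-3 : outdeg T 3 ℕ.+ outAtEnd sh₃ ≤ 2
      at-3 = local-bound 3 _ 2 (low 3<4 4≤N)
        (cong (outdeg T 3 ℕ.+_) (third-of₃ (proj₁ off₁) (proj₁ off₂) end₃))
        (cong (incidence 3 triangle ℕ.+_) (third-of₃ (proj₂ off₁) (proj₂ off₂) (incidence-end l₃ 0 s₃ 3 ends₃)))
        where
        off₁ : Quiet Q₁ P₁ 3
        off₁ = low-off os₁ ℕP.≤-refl 3 3<4 (λ ()) (λ ())
        off₂ : Quiet Q₂ P₂ 3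
        off₂ = low-off os₂ 4≤s₂ 3 3<4 (λ ()) (λ ())

    T-misses : ∀ s k → 4 ≤ s → MissesAll (Interior s k) (negW T)
    T-misses s k 4≤s v v∈ = misses-negW v T (orientation-avoids T-os (triangle-avoids v (inj₁ (ℕP.≤-trans 4≤s (proj₁ v∈)))))

    path-misses : ∀ {k s t Q} → Pointwise Orients (pathE 0 s k t) Q → t < 4 → ∀ Z → (∀ v → Z v → 4 ≤ v × ¬ Interior s k v) →
                  MissesAll Z (negW Q)
    path-misses {k} {s} {t} {Q} os t<4 Z outside v v∈ =
      misses-negW v Q (orientation-misses k 0 s t Q os v (big≢ (proj₁ (outside v v∈)) z<s) (big≢ (proj₁ (outside v v∈)) t<4) (proj₂ (outside v v∈)))

    reduced-misses-big : ∀ t sh w → t < 4 → ∀ Z → (∀ v → Z v → 4 ≤ v) → MissesAll Z (reduced 0 t sh w)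
    reduced-misses-big t sh w t<4 Z big v v∈ = reduced-misses v 0 t sh w (big≢ (big v v∈) z<s) (big≢ (big v v∈) t<4)

    misses-++ : ∀ {Z A B} → MissesAll Z A → MissesAll Z B → MissesAll Z (A ++ B)
    misses-++ A-misses B-misses v v∈ = All.++⁺ (A-misses v v∈) (B-misses v v∈)

    in₁ : ∀ v → Interior 4 l₁ v → 4 ≤ v
    in₁ v v∈ = proj₁ v∈
    in₂ : ∀ v → Interior s₂ l₂ v → 4 ≤ v
    in₂ v v∈ = ℕP.≤-trans 4≤s₂ (proj₁ v∈)
    in₃ : ∀ v → Interior s₃ l₃ v → 4 ≤ v
    in₃ v v∈ = ℕP.≤-trans 4≤s₃ (proj₁ v∈)

    σ-to-core : ∀ w → pathSign l₁ ≡ w → pathSign l₂ ≡ w → pathSign l₃ ≡ w →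
                σ N (λ _ → + 0) (negW (T ++ (Q₁ ++ (Q₂ ++ Q₃)))) ≡ σ 4 (λ _ → + 0) (coreArcs T sh₁ sh₂ sh₃ w)
    σ-to-core w sign₁ sign₂ sign₃ = begin
        σ N z (negW (T ++ (Q₁ ++ (Q₂ ++ Q₃))))
      ≡⟨ cong (σ N z) (trans (negW-++ T _) (cong (negW T ++_) (trans (negW-++ Q₁ _) (cong (negW Q₁ ++_) (negW-++ Q₂ Q₃))))) ⟩
        σ N z (negW T ++ (negW Q₁ ++ (negW Q₂ ++ negW Q₃)))
      ≡⟨ reduce-in-context Q₁ C₁ reduces₁ N (negW T) _ (ℕP.≤-trans s₂≤s₃ s₃≤N) (T-misses 4 l₁ ℕP.≤-refl)
           (misses-++ (path-misses os₂ 2<4 _ (λ v v∈ → in₁ v v∈ , interiors-disjoint ℕP.≤-refl v∈))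
                      (path-misses os₃ 3<4 _ (λ v v∈ → in₁ v v∈ , interiors-disjoint s₂≤s₃ v∈))) ⟩
        σ N z (negW T ++ (C₁ ++ (negW Q₂ ++ negW Q₃)))
      ≡⟨ cong (σ N z) (sym (++-assoc (negW T) C₁ _)) ⟩
        σ N z ((negW T ++ C₁) ++ (negW Q₂ ++ negW Q₃))
      ≡⟨ reduce-in-context Q₂ C₂ reduces₂ N (negW T ++ C₁) _ s₃≤N
           (misses-++ (T-misses s₂ l₂ 4≤s₂) (reduced-misses-big 1 sh₁ _ 1<4 _ in₂))
           (path-misses os₃ 3<4 _ (λ v v∈ → in₂ v v∈ , interiors-disjoint ℕP.≤-refl v∈)) ⟩
        σ N z ((negW T ++ C₁) ++ (C₂ ++ negW Q₃))
      ≡⟨ cong (σ N z) (trans (sym (++-assoc (negW T ++ C₁) C₂ _)) (cong (((negW T ++ C₁) ++ C₂) ++_) (sym (++-identityʳ _)))) ⟩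
        σ N z (((negW T ++ C₁) ++ C₂) ++ (negW Q₃ ++ []))
      ≡⟨ reduce-in-context Q₃ C₃ reduces₃ N ((negW T ++ C₁) ++ C₂) [] ℕP.≤-refl
           (misses-++ (misses-++ (T-misses s₃ l₃ 4≤s₃) (reduced-misses-big 1 sh₁ _ 1<4 _ in₃)) (reduced-misses-big 2 sh₂ _ 2<4 _ in₃))
           (λ _ _ → []) ⟩
        σ N z (((negW T ++ C₁) ++ C₂) ++ (C₃ ++ []))
      ≡⟨ cong (σ N z) (trans (regroup (negW T) C₁ C₂ C₃) same-sign) ⟩
        σ N z (coreArcs T sh₁ sh₂ sh₃ w)
      ≡⟨ σ-restrict 4 N _ z 4≤N core-within (λ _ _ _ → refl) ⟩
        σ 4 z (coreArcs T sh₁ sh₂ sh₃ w)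
      ∎
      where
      open ≡-Reasoning
      z : ℕ → ℤ
      z _ = + 0
      C₁ C₂ C₃ : List WArc
      C₁ = reduced 0 1 sh₁ (pathSign l₁)
      C₂ = reduced 0 2 sh₂ (pathSign l₂)
      C₃ = reduced 0 3 sh₃ (pathSign l₃)
      same-sign : negW T ++ (C₁ ++ (C₂ ++ C₃)) ≡ coreArcs T sh₁ sh₂ sh₃ w
      same-sign rewrite sign₁ | sign₂ | sign₃ = refl
      regroup : ∀ (A B C D : List WArc) → ((A ++ B) ++ C) ++ (D ++ []) ≡ A ++ (B ++ (C ++ D))
      regroup A B C D = trans (++-assoc (A ++ B) C (D ++ [])) (trans (++-assoc A B (C ++ (D ++ [])))
                          (cong (λ X → A ++ (B ++ (C ++ X))) (++-identityʳ D)))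
      core-within : All (λ p → Within 4 (proj₁ p)) (coreArcs T sh₁ sh₂ sh₃ w)
      core-within = All.++⁺ (negW-within 4 T (orientation-within T-os ((1<4 , 2<4) ∷ (1<4 , 3<4) ∷ (2<4 , 3<4) ∷ [])))
        (All.++⁺ (reduced-within 4 0 1 sh₁ w z<s 1<4) (All.++⁺ (reduced-within 4 0 2 sh₂ w z<s 2<4) (reduced-within 4 0 3 sh₃ w z<s 3<4)))

    signed-count-vanishes : ∀ w → w ∈ signs → pathSign l₁ ≡ w → pathSign l₂ ≡ w → pathSign l₃ ≡ w →
               σ N (λ _ → + 0) (negW (T ++ (Q₁ ++ (Q₂ ++ Q₃)))) ≡ + 0
    signed-count-vanishes w w∈ sign₁ sign₂ sign₃ =
      trans (σ-to-core w sign₁ sign₂ sign₃) (core-vanishes T sh₁ sh₂ sh₃ w T-os w∈ core-bounded)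

  K4sub-vanishes : ∀ w → w ∈ signs → pathSign l₁ ≡ w → pathSign l₂ ≡ w → pathSign l₃ ≡ w →
    ∀ D → IsOrientation (K4sub l₁ l₂ l₃) D → Bounded (K4sub l₁ l₂ l₃) (hx 0) D → σ N (λ _ → + 0) (negW D) ≡ + 0
  K4sub-vanishes w w∈ sign₁ sign₂ sign₃ D D-orients bounded
    with orientation-++ triangle (P₁ ++ (P₂ ++ P₃)) D-orients
  ... | T , D' , refl , T-os , os' with orientation-++ P₁ (P₂ ++ P₃) os'
  ... | Q₁ , D'' , refl , os₁ , os'' with orientation-++ P₂ P₃ os''
  ... | Q₂ , Q₃ , refl , os₂ , os₃ = Orientation.signed-count-vanishes T Q₁ Q₂ Q₃ T-os os₁ os₂ os₃ bounded w w∈ sign₁ sign₂ sign₃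

-- Simplicity of K4sub: two edges are distinct when one has an endpoint
-- where the other has none.

BothIn : (ℕ → Set) → Arc → Set
BothIn V e = V (proj₁ e) × V (proj₂ e)

OneIn : (ℕ → Set) → Arc → Set
OneIn P e = P (proj₁ e) ⊎ P (proj₂ e)

Distinct : Arc → Arc → Set
Distinct e e' = ¬ SameEnds e e'

module _ {P V : ℕ → Set} (disjoint : ∀ v → P v → ¬ V v) where

  separated : ∀ {e e'} → OneIn P e → BothIn V e' → Distinct e e'
  separated (inj₁ p) (v₁ , v₂) (inj₁ refl) = disjoint _ p v₁
  separated (inj₂ p) (v₁ , v₂) (inj₁ refl) = disjoint _ p v₂
  separated (inj₁ p) (v₁ , v₂) (inj₂ refl) = disjoint _ p v₂
  separated (inj₂ p) (v₁ , v₂) (inj₂ refl) = disjoint _ p v₁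

  separated' : ∀ {e e'} → OneIn P e → BothIn V e' → Distinct e' e
  separated' one both (inj₁ refl) = separated one both (inj₁ refl)
  separated' one both (inj₂ refl) = separated one both (inj₂ refl)

  separated-lists : ∀ A B → All (OneIn P) A → All (BothIn V) B →
                    All (λ e → All (Distinct e) B) A × All (λ e → All (Distinct e) A) B
  separated-lists A B ones boths =
    All.map (λ one → All.map (separated one) boths) ones ,
    All.map (λ both → All.map (λ one → separated' one both) ones) boths

OnPath : ℕ → ℕ → ℕ → ℕ → ℕ → Set
OnPath u s k t v = v ≡ u ⊎ v ≡ t ⊎ Interior s k v

on-rest : ∀ u s k t v → OnPath s (suc s) k t v → OnPath u s (suc k) t v
on-rest u s k t v (inj₁ refl)        = inj₂ (inj₂ (interior-first s k))
on-rest u s k t v (inj₂ (inj₁ v≡t))  = inj₂ (inj₁ v≡t)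
on-rest u s k t v (inj₂ (inj₂ v∈))   = inj₂ (inj₂ (interior-rest s k v v∈))

PathEdges : ℕ → ℕ → ℕ → ℕ → List Arc → Set
PathEdges u s k t = All (λ e → BothIn (OnPath u s k t) e × proj₁ e ≢ proj₂ e)

path-edges : ∀ k u s t → Ends u s t → PathEdges u s k t (pathE u s k t)
path-edges zero    u s t ends = ((inj₁ refl , inj₂ (inj₁ refl)) , Ends.u≢t ends) ∷ []
path-edges (suc k) u s t ends =
  ((inj₁ refl , inj₂ (inj₂ (interior-first s k))) , (λ eq → ℕP.<-irrefl eq (Ends.u<s ends)))
  ∷ All.map (λ { ((on₁ , on₂) , not-loop) → (on-rest u s k t _ on₁ , on-rest u s k t _ on₂) , not-loop })
            (path-edges k s (suc s) t (ends-rest ends))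

-- the edges of a path are pairwise distinct: the first one contains u, which
-- is not a vertex of the rest of the path
path-distinct : ∀ k u s t → Ends u s t → AllPairs Distinct (pathE u s k t)
path-distinct zero    u s t ends = [] ∷ []
path-distinct (suc k) u s t ends =
  All.map (λ edge → separated u-off (inj₁ refl) (proj₁ edge)) (path-edges k s (suc s) t (ends-rest ends))
  ∷ path-distinct k s (suc s) t (ends-rest ends)
  where
  u-off : ∀ v → v ≡ u → ¬ OnPath s (suc s) k t v
  u-off v refl (inj₁ refl)        = ℕP.<-irrefl refl (Ends.u<s ends)
  u-off v refl (inj₂ (inj₁ v≡t))  = Ends.u≢t ends v≡t
  u-off v refl (inj₂ (inj₂ v∈))   = ℕP.<-asym (Ends.u<s ends) (proj₁ v∈)

path-near-end : ∀ k u s t → All (OneIn (λ v → v ≡ t ⊎ Interior s k v)) (pathE u s k t)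
path-near-end zero    u s t = inj₂ (inj₁ refl) ∷ []
path-near-end (suc k) u s t = inj₂ (inj₂ (interior-first s k)) ∷ All.map widen (path-near-end k s (suc s) t)
  where
  widen₁ : ∀ {v} → v ≡ t ⊎ Interior (suc s) k v → v ≡ t ⊎ Interior s (suc k) v
  widen₁ (inj₁ v≡t) = inj₁ v≡t
  widen₁ (inj₂ v∈)  = inj₂ (interior-rest s k _ v∈)
  widen : ∀ {e} → OneIn (λ v → v ≡ t ⊎ Interior (suc s) k v) e → OneIn (λ v → v ≡ t ⊎ Interior s (suc k) v) e
  widen (inj₁ p) = inj₁ (widen₁ p)
  widen (inj₂ p) = inj₂ (widen₁ p)

path-near-start : ∀ k u s t → All (OneIn (λ v → v ≡ u ⊎ Interior s k v)) (pathE u s k t)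
path-near-start zero    u s t = inj₁ (inj₁ refl) ∷ []
path-near-start (suc k) u s t = inj₁ (inj₁ refl) ∷ All.map widen (path-near-start k s (suc s) t)
  where
  widen₁ : ∀ {v} → v ≡ s ⊎ Interior (suc s) k v → v ≡ u ⊎ Interior s (suc k) v
  widen₁ (inj₁ refl) = inj₂ (interior-first s k)
  widen₁ (inj₂ v∈)   = inj₂ (interior-rest s k _ v∈)
  widen : ∀ {e} → OneIn (λ v → v ≡ s ⊎ Interior (suc s) k v) e → OneIn (λ v → v ≡ u ⊎ Interior s (suc k) v) e
  widen (inj₁ p) = inj₁ (widen₁ p)
  widen (inj₂ p) = inj₂ (widen₁ p)

private-off : ∀ {t s k t' s' k'} → t < 4 → t' < 4 → 4 ≤ s → 4 ≤ s' → t ≢ 0 → t ≢ t' → s ℕ.+ k ≤ s' →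
              ∀ v → v ≡ t ⊎ Interior s k v → ¬ OnPath 0 s' k' t' v
private-off t<4 t'<4 4≤s 4≤s' t≢0 t≢t' le v (inj₁ refl) (inj₁ v≡0)        = t≢0 v≡0
private-off t<4 t'<4 4≤s 4≤s' t≢0 t≢t' le v (inj₁ refl) (inj₂ (inj₁ v≡t')) = t≢t' v≡t'
private-off t<4 t'<4 4≤s 4≤s' t≢0 t≢t' le v (inj₁ refl) (inj₂ (inj₂ v∈'))  =
  ℕP.<-irrefl refl (ℕP.<-≤-trans t<4 (ℕP.≤-trans 4≤s' (proj₁ v∈')))
private-off t<4 t'<4 4≤s 4≤s' t≢0 t≢t' le v (inj₂ v∈) (inj₁ refl)         = ℕP.<-irrefl refl (ℕP.<-≤-trans z<s (ℕP.≤-trans 4≤s (proj₁ v∈)))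
private-off t<4 t'<4 4≤s 4≤s' t≢0 t≢t' le v (inj₂ v∈) (inj₂ (inj₁ refl))  = ℕP.<-irrefl refl (ℕP.<-≤-trans t'<4 (ℕP.≤-trans 4≤s (proj₁ v∈)))
private-off t<4 t'<4 4≤s 4≤s' t≢0 t≢t' le v (inj₂ v∈) (inj₂ (inj₂ v∈'))   = interiors-disjoint le v∈ v∈'

module K4Simple (l₁ l₂ l₃ : ℕ) where
  open K4Sub l₁ l₂ l₃

  edges₁ : PathEdges 0 4 l₁ 1 P₁
  edges₁ = path-edges l₁ 0 4 1 ends₁
  edges₂ : PathEdges 0 s₂ l₂ 2 P₂
  edges₂ = path-edges l₂ 0 s₂ 2 ends₂
  edges₃ : PathEdges 0 s₃ l₃ 3 P₃
  edges₃ = path-edges l₃ 0 s₃ 3 ends₃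

  on-path<N : ∀ {s k t} → t < 4 → s ℕ.+ k ≤ N → ∀ v → OnPath 0 s k t v → v < N
  on-path<N t<4 le v (inj₁ refl)        = low z<s 4≤N
  on-path<N t<4 le v (inj₂ (inj₁ refl)) = low t<4 4≤N
  on-path<N t<4 le v (inj₂ (inj₂ v∈))   = ℕP.<-≤-trans (proj₂ v∈) le

  path-within : ∀ {k s t} → t < 4 → s ℕ.+ k ≤ N → PathEdges 0 s k t (pathE 0 s k t) → All (Within N) (pathE 0 s k t)
  path-within t<4 le = All.map (λ { ((on₁ , on₂) , _) → on-path<N t<4 le _ on₁ , on-path<N t<4 le _ on₂ })

  within : All (Within N) (edges (K4sub l₁ l₂ l₃))
  within = (low 1<4 4≤N , low 2<4 4≤N) ∷ (low 1<4 4≤N , low 3<4 4≤N) ∷ (low 2<4 4≤N , low 3<4 4≤N)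
    ∷ All.++⁺ (path-within 1<4 (ℕP.≤-trans s₂≤s₃ s₃≤N) edges₁) (All.++⁺ (path-within 2<4 s₃≤N edges₂) (path-within 3<4 ℕP.≤-refl edges₃))

  no-loops : All (λ e → proj₁ e ≢ proj₂ e) (edges (K4sub l₁ l₂ l₃))
  no-loops = (λ ()) ∷ (λ ()) ∷ (λ ()) ∷ All.++⁺ (All.map proj₂ edges₁) (All.++⁺ (All.map proj₂ edges₂) (All.map proj₂ edges₃))

  both₂ : All (BothIn (OnPath 0 s₂ l₂ 2)) P₂
  both₂ = All.map proj₁ edges₂
  both₃ : All (BothIn (OnPath 0 s₃ l₃ 3)) P₃
  both₃ = All.map proj₁ edges₃

  paths-distinct : AllPairs Distinct (P₁ ++ (P₂ ++ P₃))
  paths-distinct = AllPairs.++⁺ (path-distinct l₁ 0 4 1 ends₁)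
    (AllPairs.++⁺ (path-distinct l₂ 0 s₂ 2 ends₂) (path-distinct l₃ 0 s₃ 3 ends₃)
      (proj₁ (separated-lists (private-off 2<4 3<4 4≤s₂ 4≤s₃ (λ ()) (λ ()) ℕP.≤-refl) P₂ P₃ (path-near-end l₂ 0 s₂ 2) both₃)))
    (All.zipWith (λ (d₂ , d₃) → All.++⁺ d₂ d₃)
      (proj₁ (separated-lists (private-off 1<4 2<4 ℕP.≤-refl 4≤s₂ (λ ()) (λ ()) ℕP.≤-refl) P₁ P₂ (path-near-end l₁ 0 4 1) both₂) ,
       proj₁ (separated-lists (private-off 1<4 3<4 ℕP.≤-refl 4≤s₃ (λ ()) (λ ()) s₂≤s₃) P₁ P₃ (path-near-end l₁ 0 4 1) both₃)))

  -- path edges all touch 0 or a vertex ≥ 4; triangle edges lie within 1..3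
  triangle-vs-paths : All (λ e → All (Distinct e) (P₁ ++ (P₂ ++ P₃))) triangle
  triangle-vs-paths = proj₂ (separated-lists outside (P₁ ++ (P₂ ++ P₃)) triangle
      (All.++⁺ (All.map (widen 4 l₁ ℕP.≤-refl) (path-near-start l₁ 0 4 1))
        (All.++⁺ (All.map (widen s₂ l₂ 4≤s₂) (path-near-start l₂ 0 s₂ 2)) (All.map (widen s₃ l₃ 4≤s₃) (path-near-start l₃ 0 s₃ 3))))
      (((z<s , 1<4) , (z<s , 2<4)) ∷ ((z<s , 1<4) , (z<s , 3<4)) ∷ ((z<s , 2<4) , (z<s , 3<4)) ∷ []))
    where
    outside : ∀ v → v ≡ 0 ⊎ 4 ≤ v → ¬ (0 < v × v < 4)
    outside v (inj₁ refl) (() , _)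
    outside v (inj₂ 4≤v) (_ , v<4) = ℕP.<-irrefl refl (ℕP.<-≤-trans v<4 4≤v)
    widen : ∀ s k → 4 ≤ s → ∀ {e} → OneIn (λ v → v ≡ 0 ⊎ Interior s k v) e → OneIn (λ v → v ≡ 0 ⊎ 4 ≤ v) e
    widen s k 4≤s (inj₁ (inj₁ v≡0)) = inj₁ (inj₁ v≡0)
    widen s k 4≤s (inj₁ (inj₂ v∈))  = inj₁ (inj₂ (ℕP.≤-trans 4≤s (proj₁ v∈)))
    widen s k 4≤s (inj₂ (inj₁ v≡0)) = inj₂ (inj₁ v≡0)
    widen s k 4≤s (inj₂ (inj₂ v∈))  = inj₂ (inj₂ (ℕP.≤-trans 4≤s (proj₁ v∈)))

  triangle-distinct : AllPairs Distinct triangle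
  triangle-distinct = ((λ { (inj₁ ()) ; (inj₂ ()) }) ∷ (λ { (inj₁ ()) ; (inj₂ ()) }) ∷ [])
                    ∷ ((λ { (inj₁ ()) ; (inj₂ ()) }) ∷ []) ∷ [] ∷ []

  K4sub-simple : Simple (K4sub l₁ l₂ l₃)
  K4sub-simple = within , no-loops , AllPairs.++⁺ triangle-distinct paths-distinct triangle-vs-paths

-- The Moser spindle, with x = 6: every one of its 2^11 orientations either
-- violates the bounds or has signed count zero, by computation.
moser-table : All (λ D → Bounded moser (hx 6) D → σ 7 (λ _ → + 0) (negW D) ≡ + 0) (orientationsOf (edges moser))
moser-table = from-yes (All.all? (λ D → bounded? moser (hx 6) D →-dec (σ 7 (λ _ → + 0) (negW D) ℤ.≟ + 0)) (orientationsOf (edges moser)))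

moser-simple : Simple moser
moser-simple = from-yes
  (All.all? (λ e → (proj₁ e <? 7) ×-dec (proj₂ e <? 7)) (edges moser)
   ×-dec All.all? (λ e → ¬? (proj₁ e ℕ.≟ proj₂ e)) (edges moser)
   ×-dec allPairs? (λ e f → ¬? (arc? e f ⊎-dec arc? e (swap f))) (edges moser))
  where
  arc? : (e f : Arc) → Dec (e ≡ f)
  arc? = ProductP.≡-dec ℕ._≟_ ℕ._≟_

moser-vanishes : ∀ D → IsOrientation moser D → Bounded moser (hx 6) D → σ 7 (λ _ → + 0) (negW D) ≡ + 0
moser-vanishes D D-orients = All.lookup moser-table (orientation∈ (edges moser) D D-orients)

pathSign-parity : ∀ l → (Odd (suc l) × pathSign l ≡ -[1+ 0 ]) ⊎ (Even (suc l) × pathSign l ≡ + 1)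
pathSign-parity zero = inj₁ (refl , refl)
pathSign-parity (suc l) with pathSign-parity l
... | inj₁ (odd , sign)  = inj₂ (Equivalence.from (suc-even⇔odd (suc l)) odd , cong (-[1+ 0 ] ℤ.*_) sign)
... | inj₂ (even , sign) = inj₁ (Equivalence.from (suc-odd⇔even (suc l)) even , cong (-[1+ 0 ] ℤ.*_) sign)

pathSign-odd : ∀ l → Odd (suc l) → pathSign l ≡ -[1+ 0 ]
pathSign-odd l odd with pathSign-parity l
... | inj₁ (_ , sign)  = sign
... | inj₂ (even , _) = ⊥-elim (0≢1 (trans (sym even) odd))

pathSign-even : ∀ l → Even (suc l) → pathSign l ≡ + 1
pathSign-even l even with pathSign-parity l
... | inj₁ (odd , _)  = ⊥-elim (0≢1 (trans (sym even) odd))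
... | inj₂ (_ , sign) = sign

not-AT : ∀ G x H y → Simple G → Simple H → IsoAt G x H y →
         (∀ D → IsOrientation H D → Bounded H (hx y) D → σ (n H) (λ _ → + 0) (negW D) ≡ + 0) →
         ¬ IsAT G (hx x)
not-AT G x H y G-simple H-simple iso vanishes AT with Transfer.transfer G H x y G-simple H-simple iso AT
... | D , D-orients , D-bounded , σ≢0 = σ≢0 (vanishes D D-orients D-bounded)

proposition1 : (G : Graph) (x : ℕ) → Simple G → InD G x → ¬ IsAT G (hx x)
proposition1 G x G-simple (typeA l₁ l₂ l₃ odd₁ odd₂ odd₃ iso) =
  not-AT G x (K4sub l₁ l₂ l₃) 0 G-simple (K4Simple.K4sub-simple l₁ l₂ l₃) iso
    (K4Sub.K4sub-vanishes l₁ l₂ l₃ -[1+ 0 ] (here refl) (pathSign-odd l₁ odd₁) (pathSign-odd l₂ odd₂) (pathSign-odd l₃ odd₃))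
proposition1 G x G-simple (typeB l₁ l₂ l₃ even₁ even₂ even₃ iso) =
  not-AT G x (K4sub l₁ l₂ l₃) 0 G-simple (K4Simple.K4sub-simple l₁ l₂ l₃) iso
    (K4Sub.K4sub-vanishes l₁ l₂ l₃ (+ 1) (there (here refl)) (pathSign-even l₁ even₁) (pathSign-even l₂ even₂) (pathSign-even l₃ even₃))
proposition1 G x G-simple (typeC iso) =
  not-AT G x moser 6 G-simple moser-simple iso moser-vanishes
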